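{- There exists an oracle $A$ and an $A$-scalable set $B$ such that $\mathrm{census}_B\notin\mathrm{FP}^A$.
   Context: Strings are over $\Sigma=\{0,1\}$, with $\le$ the standard lexicographic order. $\mathrm{census}_B(1^n)=|\{x\in B:|x|=n\}|$. A set is rankable in $\mathrm{FP}^X$ if its ranking function $x\mapsto|\{y\le x:y\in$ set$\}|$ is computable by a deterministic polynomial-time oracle transducer with oracle $X$. A $\mathrm{P}^X$-isomorphism is a bijection $\phi:\Sigma^*\to\Sigma^*$ with $\phi,\phi^{ -1}\in\mathrm{FP}^X$. A set is $X$-scalable if there is a $\mathrm{P}^X$-isomorphism mapping it onto some set rankable in $\mathrm{FP}^X$. -}

module Defs where

open import Data.Bool using (Bool; true; false; if_then_else_)
open import Data.Nat using (ℕ; zero; suc; _+_; _^_; _<ᵇ_; _≡ᵇ_)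
open import Data.Nat.DivMod using (_/_; _%_)
open import Data.List using (List; []; _∷_; _++_; map; reverse; length; concatMap; upTo; replicate)
open import Data.Nat.ListAction using (sum)
open import Data.Fin using (Fin)
open import Data.Maybe using (Maybe; just; nothing)
open import Data.Product using (Σ; _×_)
open import Relation.Binary.PropositionalEquality using (_≡_)

-- Strings over Σ = {0,1} (false = 0, true = 1) and sets/oracles

Str : Set
Str = List Bool

Lang : Set
Lang = Str → Bool

-- Deterministic oracle Turing transducers
-- Two one-way-infinite tapes: a work tape (holds the input at the start,
-- the output at the end) and an oracle query tape.

data Sym : Set where
  blank s0 s1 : Sym

data Move : Set where
  L R S : Move

record Tape : Set where
  constructor tape
  field
    left  : List Sym   -- cells to the left of the head, nearest first
    here  : Sym
    right : List Sym
open Tape public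

emptyTape : Tape
emptyTape = tape [] blank []

moveT : Move → Tape → Tape
moveT L (tape [] h r)       = tape [] h r
moveT L (tape (l ∷ ls) h r) = tape ls l (h ∷ r)
moveT R (tape ls h [])       = tape (h ∷ ls) blank []
moveT R (tape ls h (x ∷ rs)) = tape (h ∷ ls) x rs
moveT S t = t

writeT : Sym → Tape → Tape
writeT s (tape l _ r) = tape l s r

symOf : Bool → Sym
symOf false = s0
symOf true  = s1

-- binary string written from cell 0 up to (excluding) the first blank
symsToStr : List Sym → Str
symsToStr []           = []
symsToStr (blank ∷ _)  = []
symsToStr (s0 ∷ xs)    = false ∷ symsToStr xs
symsToStr (s1 ∷ xs)    = true ∷ symsToStr xs

readTape : Tape → Str
readTape (tape l h r) = symsToStr (reverse l ++ h ∷ r)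

inputTape : Str → Tape
inputTape []       = emptyTape
inputTape (b ∷ bs) = tape [] (symOf b) (map symOf bs)

data Action (n : ℕ) : Set where
  halt  : Action n
  -- query the oracle on the string on the query tape; go to the first
  -- state on "yes", the second on "no"; the query tape is then erased
  query : Fin n → Fin n → Action n
  -- new state, (write, move) on work tape, (write, move) on query tape
  step  : Fin n → Sym → Move → Sym → Move → Action n

record OTM : Set where
  field
    states : ℕ
    start  : Fin states
    δ      : Fin states → Sym → Sym → Action states

record Config (M : OTM) : Set where
  constructor cfg
  field
    state : Fin (OTM.states M)
    work  : Tape
    qtape : Tape

initConfig : (M : OTM) → Str → Config M
initConfig M x = cfg (OTM.start M) (inputTape x) emptyTape

stepConfig : Lang → (M : OTM) → Config M → Maybe (Config M)
stepConfig A M (cfg q w t) with OTM.δ M q (here w) (here t)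
... | halt = nothing
... | query qy qn = just (cfg (if A (readTape t) then qy else qn) w emptyTape)
... | step q' a m b m' = just (cfg q' (moveT m (writeT a w)) (moveT m' (writeT b t)))

runFor : Lang → (M : OTM) → ℕ → Config M → Config M
runFor A M zero c = c
runFor A M (suc t) c with stepConfig A M c
... | nothing = c
... | just c' = runFor A M t c'

isHalted : (M : OTM) → Config M → Bool
isHalted M (cfg q w t) with OTM.δ M q (here w) (here t)
... | halt = true
... | _    = false

output : (M : OTM) → Config M → Str
output M c = readTape (Config.work c)

ComputesIn : Lang → OTM → (Str → Str) → ℕ → Set
ComputesIn X M f k = ∀ (x : Str) →
  let c = runFor X M (length x ^ k + k) (initConfig M x)
  in (isHalted M c ≡ true) × (output M c ≡ f x)

FP : Lang → (Str → Str) → Set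
FP X f = Σ OTM λ M → Σ ℕ λ k → ComputesIn X M f k

-- Binary encoding of natural numbers (most significant bit first; 0 ↦ ε)

bitsLSB : ℕ → ℕ → List Bool   -- fuel, number
bitsLSB zero n = []
bitsLSB (suc f) zero = []
bitsLSB (suc f) (suc n) = ((suc n % 2) ≡ᵇ 1) ∷ bitsLSB f (suc n / 2)

bin : ℕ → Str
bin n = reverse (bitsLSB n n)

allStrings : ℕ → List Str
allStrings zero = [] ∷ []
allStrings (suc n) = map (false ∷_) (allStrings n) ++ map (true ∷_) (allStrings n)

count : Lang → List Str → ℕ
count B xs = sum (map (λ x → if B x then 1 else 0) xs)

census : Lang → ℕ → ℕ
census B n = count B (allStrings n)

-- lexicographic comparison of strings (0 < 1), used on equal lengths
lexLeq : Str → Str → Bool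
lexLeq [] _ = true
lexLeq (_ ∷ _) [] = false
lexLeq (false ∷ x) (true ∷ y) = true
lexLeq (true ∷ x) (false ∷ y) = false
lexLeq (false ∷ x) (false ∷ y) = lexLeq x y
lexLeq (true ∷ x) (true ∷ y) = lexLeq x y

stdLeq : Str → Str → Bool
stdLeq x y = if length x <ᵇ length y then true
             else if length x ≡ᵇ length y then lexLeq x y else false

-- rank_C(x) = |{ y ≤ x : y ∈ C }|  (all such y have |y| ≤ |x|)
rank : Lang → Str → ℕ
rank C x = count (λ y → if stdLeq y x then C y else false)
                 (concatMap allStrings (upTo (suc (length x))))

RankableIn : Lang → Lang → Set
RankableIn X C = FP X (λ x → bin (rank C x))

record PIso (X : Lang) : Set where
  field
    φ     : Str → Str
    ψ     : Str → Str
    ψ∘φ   : ∀ x → ψ (φ x) ≡ x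
    φ∘ψ   : ∀ y → φ (ψ y) ≡ y
    φ-FP  : FP X φ
    ψ-FP  : FP X ψ

Scalable : Lang → Lang → Set
Scalable X B = Σ (PIso X) λ iso → Σ Lang λ C →
  (∀ x → C (PIso.φ iso x) ≡ B x) × RankableIn X C

CensusInFP : Lang → Lang → Set
CensusInFP A B = Σ (Str → Str) λ f → FP A f × (∀ n → f (replicate n true) ≡ bin (census B n))

{-# OPTIONS --safe #-}
-- A = {1y, 0y0 : y ∈ D} for a set D built by diagonalization. With a single query to A on its input,
-- swap A exchanges 1y and 0y0 for y ∈ D and fixes every other string; it is an involution, hence a
-- P^A-isomorphism, and it maps B = {x : swap A x starts with 1} onto the strings starting with 1, whose
-- rank needs no oracle at all. So B is A-scalable, while census_B(m + 1) = 2^m − |D ∩ Σ^m| whenever D has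
-- no string of length m − 1.
-- Stage i of the construction of D takes the i-th machine Mᵢ with time bound n^kᵢ + kᵢ and a length m
-- so large that the run of Mᵢ on 1^(m+1) asks fewer than 2^m queries and later stages work beyond every
-- query it can ask. If Mᵢ outputs 2^m, a string of length m that is not the y of any queried 1y or 0y0 is
-- put into D, so census_B(m + 1) = 2^m − 1; otherwise D gets nothing at length m and census_B(m + 1) = 2^m.
-- Either way Mᵢ does not compute the census.

module Submission where

open import Defs
open import Data.Bool using (Bool; true; false; if_then_else_; not; _∧_)
open import Data.Bool.Properties using () renaming (_≟_ to _≟ᵇ_)
open import Data.Empty using (⊥; ⊥-elim)
open import Data.Fin using (Fin; zero; suc; toℕ; #_)
open import Data.Maybe using (Maybe; just; nothing)
open import Data.Nat using (ℕ; zero; suc; _+_; _*_; _∸_; _^_; _≤_; _<_; _<?_; z≤n; s≤s; _≡ᵇ_; >-nonZero)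
open import Data.Nat.Properties
open import Data.Nat.DivMod using (_/_; _%_; m/n<m; m*n%n≡0; [m+kn]%n≡m%n; m*n/n≡m; +-distrib-/)
open import Data.Nat.ListAction using (sum)
open import Data.Nat.ListAction.Properties using (sum-++)
open import Data.Nat.Tactic.RingSolver using (solve-∀)
open import Data.List using (List; []; _∷_; _++_; _∷ʳ_; _ʳ++_; map; length; reverse; replicate; drop; concatMap; upTo)
open import Data.List.Properties
  using ( ++-assoc; ++-identityʳ; map-++; map-∘; map-replicate; length-++; length-map; length-replicate; length-reverse
        ; length-drop; reverse-++; reverse-map; reverse-involutive; unfold-reverse; upTo-∷ʳ; concatMap-++; ≡-dec )
open import Data.List.Relation.Unary.Any as Any using (there)
open import Data.List.Relation.Unary.All as All using (All; []; _∷_)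
open import Data.List.Membership.Propositional using (_∈_; _∉_)
open import Data.List.Membership.Propositional.Properties using (∈-++⁺ˡ; ∈-++⁺ʳ; ∈-++⁻; ∈-map⁺)
open import Data.List.Membership.DecPropositional (≡-dec _≟ᵇ_) using (_∈?_)
open import Data.Vec using (Vec; []; _∷_; lookup; tabulate)
open import Data.Vec.Properties using (lookup∘tabulate)
open import Data.Product using (Σ; _×_; _,_; proj₁; proj₂)
open import Data.Sum using (_⊎_; inj₁; inj₂)
open import Function.Bundles using (_⇔_; mk⇔; Equivalence)
open import Relation.Nullary using (¬_; Dec; does; yes; no)
open import Relation.Nullary.Decidable using (dec-true; dec-false; does-⇔)
open import Relation.Binary.Definitions using (DecidableEquality; tri<; tri≈; tri>)
open import Relation.Binary.PropositionalEquality

module _ {X : Lang} {M : OTM} where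

  stepConfig-halted : ∀ c → isHalted M c ≡ true → stepConfig X M c ≡ nothing
  stepConfig-halted (cfg q w t) h with OTM.δ M q (here w) (here t)
  ... | halt = refl

  runFor-stuck : ∀ c → stepConfig X M c ≡ nothing → ∀ t → runFor X M t c ≡ c
  runFor-stuck c stuck zero = refl
  runFor-stuck c stuck (suc t) rewrite stuck = refl

  runFor-+ : ∀ a b c → runFor X M (a + b) c ≡ runFor X M b (runFor X M a c)
  runFor-+ zero b c = refl
  runFor-+ (suc a) b c with stepConfig X M c in stuck
  ... | nothing = sym (runFor-stuck c stuck b)
  ... | just c′ = runFor-+ a b c′

record HaltsWithin (X : Lang) (M : OTM) (c : Config M) (t : ℕ) (out : Str) : Set where
  field
    final   : Config M
    reaches : runFor X M t c ≡ final
    halted  : isHalted M final ≡ true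
    outputs : output M final ≡ out
open HaltsWithin

module _ {X : Lang} {M : OTM} where

  halts-now : ∀ c → isHalted M c ≡ true → HaltsWithin X M c 0 (output M c)
  halts-now c h = record { final = c ; reaches = refl ; halted = h ; outputs = refl }

  halts-after : ∀ a {c c′ t out} → runFor X M a c ≡ c′ →
                HaltsWithin X M c′ t out → HaltsWithin X M c (a + t) out
  halts-after a {c} {t = t} c→c′ h = record
    { final = final h ; halted = halted h ; outputs = outputs h
    ; reaches = trans (runFor-+ a t c) (trans (cong (runFor X M t) c→c′) (reaches h)) }

  halts-mono : ∀ {c t t′ out} → t ≤ t′ → HaltsWithin X M c t out → HaltsWithin X M c t′ out
  halts-mono {c} {t} {t′} t≤t′ h = record
    { final = final h ; halted = halted h ; outputs = outputs h ; reaches = begin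
      runFor X M t′ c               ≡⟨ cong (λ u → runFor X M u c) (sym (m+[n∸m]≡n t≤t′)) ⟩
      runFor X M (t + (t′ ∸ t)) c    ≡⟨ runFor-+ t (t′ ∸ t) c ⟩
      runFor X M (t′ ∸ t) (runFor X M t c) ≡⟨ cong (runFor X M (t′ ∸ t)) (reaches h) ⟩
      runFor X M (t′ ∸ t) (final h)  ≡⟨ runFor-stuck (final h) (stepConfig-halted (final h) (halted h)) (t′ ∸ t) ⟩
      final h                        ∎ }
    where open ≡-Reasoning

  halts-cast : ∀ {c t out out′} → out ≡ out′ → HaltsWithin X M c t out → HaltsWithin X M c t out′
  halts-cast refl h = h

computesIn-byHalting : ∀ {X M f} k (time : Str → ℕ) →
  (∀ x → HaltsWithin X M (initConfig M x) (time x) (f x)) →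
  (∀ x → time x ≤ length x ^ k + k) → ComputesIn X M f k
computesIn-byHalting k time run time≤ x
  with record { reaches = refl ; halted = h ; outputs = o } ← halts-mono (time≤ x) (run x) = h , o

bit : Bool → ℕ
bit false = 0
bit true  = 1

-- valFrom a y is the number whose binary representation is that of a followed by y.
valFrom : ℕ → Str → ℕ
valFrom a []      = a
valFrom a (b ∷ y) = valFrom (bit b + a * 2) y

val : Str → ℕ
val = valFrom 0

private
  suc/2≤ : ∀ u → suc u / 2 ≤ u
  suc/2≤ zero    = z≤n
  suc/2≤ (suc u) = <⇒≤pred (m/n<m (suc (suc u)) 2 (s≤s (s≤s z≤n)))

  bitsLSB-fuel : ∀ f g u → u ≤ f → u ≤ g → bitsLSB f u ≡ bitsLSB g u
  bitsLSB-fuel zero    zero    zero _ _ = refl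
  bitsLSB-fuel zero    (suc g) zero _ _ = refl
  bitsLSB-fuel (suc f) zero    zero _ _ = refl
  bitsLSB-fuel (suc f) (suc g) zero _ _ = refl
  bitsLSB-fuel (suc f) (suc g) (suc u) (s≤s u≤f) (s≤s u≤g) =
    cong (_ ∷_) (bitsLSB-fuel f g (suc u / 2) (≤-trans (suc/2≤ u) u≤f) (≤-trans (suc/2≤ u) u≤g))

  lowBit : ∀ b u → ((bit b + u * 2) % 2 ≡ᵇ 1) ≡ b
  lowBit false u = cong (_≡ᵇ 1) (m*n%n≡0 u 2)
  lowBit true  u = cong (_≡ᵇ 1) ([m+kn]%n≡m%n 1 u 2)

  highBits : ∀ b u → (bit b + u * 2) / 2 ≡ u
  highBits false u = m*n/n≡m u 2
  highBits true  u = trans (+-distrib-/ 1 (u * 2) (subst (λ r → 1 + r < 2) (sym (m*n%n≡0 u 2)) (s≤s (s≤s z≤n))))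
                           (m*n/n≡m u 2)

  bin-suc : ∀ p u b → bit b + u * 2 ≡ suc p → u ≤ p → bin (suc p) ≡ bin u ++ b ∷ []
  bin-suc p u b n≡ u≤p = begin
      reverse ((suc p % 2 ≡ᵇ 1) ∷ bitsLSB p (suc p / 2))   ≡⟨ unfold-reverse _ (bitsLSB p (suc p / 2)) ⟩
      reverse (bitsLSB p (suc p / 2)) ++ (suc p % 2 ≡ᵇ 1) ∷ [] ≡⟨ cong₂ (λ bs c → reverse bs ++ c ∷ []) high low ⟩
      reverse (bitsLSB u u) ++ b ∷ []                       ∎
    where
    open ≡-Reasoning
    high : bitsLSB p (suc p / 2) ≡ bitsLSB u u
    high = trans (cong (bitsLSB p) (trans (cong (_/ 2) (sym n≡)) (highBits b u))) (bitsLSB-fuel p u u u≤p ≤-refl)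
    low : (suc p % 2 ≡ᵇ 1) ≡ b
    low = trans (cong (λ n → n % 2 ≡ᵇ 1) (sym n≡)) (lowBit b u)

bin-snoc : ∀ u b → 1 ≤ u → bin (bit b + u * 2) ≡ bin u ++ b ∷ []
bin-snoc (suc u) false _ = bin-suc (suc (u * 2)) (suc u) false refl (s≤s (m≤m*n u 2))
bin-snoc (suc u) true  _ = bin-suc (suc (suc (u * 2))) (suc u) true refl (s≤s (m≤n⇒m≤1+n (m≤m*n u 2)))

bin-valFrom : ∀ y a → 1 ≤ a → bin (valFrom a y) ≡ bin a ++ y
bin-valFrom []      a _   = sym (++-identityʳ (bin a))
bin-valFrom (b ∷ y) a 1≤a = begin
    bin (valFrom (bit b + a * 2) y) ≡⟨ bin-valFrom y (bit b + a * 2) (≤-trans 1≤a (≤-trans (m≤m*n a 2) (m≤n+m _ _))) ⟩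
    bin (bit b + a * 2) ++ y        ≡⟨ cong (_++ y) (bin-snoc a b 1≤a) ⟩
    (bin a ++ b ∷ []) ++ y          ≡⟨ ++-assoc (bin a) _ y ⟩
    bin a ++ b ∷ y                  ∎
  where open ≡-Reasoning

bin-valFrom-1 : ∀ y → bin (valFrom 1 y) ≡ true ∷ y
bin-valFrom-1 y = bin-valFrom y 1 (s≤s z≤n)

valFrom-split : ∀ y a → valFrom a y ≡ a * 2 ^ length y + val y
valFrom-split []      a = sym (trans (+-identityʳ _) (*-identityʳ a))
valFrom-split (b ∷ y) a = begin
    valFrom (bit b + a * 2) y                            ≡⟨ valFrom-split y (bit b + a * 2) ⟩
    (bit b + a * 2) * 2 ^ length y + val y              ≡⟨ regroup (bit b) a (2 ^ length y) (val y) ⟩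
    a * (2 * 2 ^ length y) + (bit b * 2 ^ length y + val y) ≡⟨ cong (a * (2 * 2 ^ length y) +_) (sym (valFrom-split y (bit b))) ⟩
    a * (2 * 2 ^ length y) + valFrom (bit b) y          ≡⟨ cong (λ k → a * (2 * 2 ^ length y) + valFrom k y) (sym (+-identityʳ (bit b))) ⟩
    a * (2 * 2 ^ length y) + valFrom (bit b + 0 * 2) y  ∎
  where
  open ≡-Reasoning
  regroup : ∀ c a q v → (c + a * 2) * q + v ≡ a * (2 * q) + (c * q + v)
  regroup = solve-∀

valFrom-1 : ∀ y → valFrom 1 y ≡ 2 ^ length y + val y
valFrom-1 y = trans (valFrom-split y 1) (cong (_+ val y) (*-identityˡ _))

val-zeros : ∀ m → val (replicate m false) ≡ 0
val-zeros zero    = refl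
val-zeros (suc m) = val-zeros m

bin-2^ : ∀ m → bin (2 ^ m) ≡ true ∷ replicate m false
bin-2^ m = trans (cong bin (sym 2^m≡)) (bin-valFrom-1 (replicate m false))
  where
  2^m≡ : valFrom 1 (replicate m false) ≡ 2 ^ m
  2^m≡ = trans (valFrom-1 (replicate m false))
               (trans (cong₂ _+_ (cong (2 ^_) (length-replicate m {x = false})) (val-zeros m)) (+-identityʳ _))

suc-val-ones : ∀ k → suc (val (replicate k true)) ≡ 2 ^ k
suc-val-ones zero    = refl
suc-val-ones (suc k) = begin
    suc (valFrom 1 (replicate k true))                 ≡⟨ cong suc (valFrom-1 (replicate k true)) ⟩
    suc (2 ^ length (replicate k true) + val (replicate k true)) ≡⟨ cong (λ n → suc (2 ^ n + val (replicate k true))) (length-replicate k) ⟩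
    suc (2 ^ k + val (replicate k true))               ≡⟨ sym (+-suc (2 ^ k) _) ⟩
    2 ^ k + suc (val (replicate k true))               ≡⟨ cong (2 ^ k +_) (suc-val-ones k) ⟩
    2 ^ k + 2 ^ k                                      ≡⟨ cong (2 ^ k +_) (sym (+-identityʳ (2 ^ k))) ⟩
    2 ^ suc k                                          ∎
  where open ≡-Reasoning

bin-val-ones : ∀ k → bin (val (replicate k true)) ≡ replicate k true
bin-val-ones zero    = refl
bin-val-ones (suc k) = bin-valFrom-1 (replicate k true)

bin-ones≢bin-2^ : ∀ m → bin (val (replicate m true)) ≢ bin (2 ^ m)
bin-ones≢bin-2^ m eq = 1+n≢n (begin
    suc m                                 ≡⟨ length-replicate (suc m) ⟨
    length (replicate (suc m) false)      ≡⟨ cong length (bin-2^ m) ⟨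
    length (bin (2 ^ m))                  ≡⟨ cong length eq ⟨
    length (bin (val (replicate m true))) ≡⟨ cong length (bin-val-ones m) ⟩
    length (replicate m true)             ≡⟨ length-replicate m ⟩
    m                                     ∎)
  where open ≡-Reasoning

_≟ₛ_ : DecidableEquality Str
_≟ₛ_ = ≡-dec _≟ᵇ_

count-++ : ∀ B xs ys → count B (xs ++ ys) ≡ count B xs + count B ys
count-++ B xs ys = trans (cong sum (map-++ indicator xs ys)) (sum-++ (map indicator xs) (map indicator ys))
  where
  indicator : Str → ℕ
  indicator x = if B x then 1 else 0

count-map : ∀ B (f : Str → Str) xs → count B (map f xs) ≡ count (λ x → B (f x)) xs
count-map B f xs = cong sum (sym (map-∘ xs))

census-suc : ∀ B n → census B (suc n) ≡ census (λ z → B (false ∷ z)) n + census (λ z → B (true ∷ z)) n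
census-suc B n = trans (count-++ B (map (false ∷_) (allStrings n)) _)
                       (cong₂ _+_ (count-map B _ (allStrings n)) (count-map B _ (allStrings n)))

census-cong : ∀ B B′ n → (∀ z → length z ≡ n → B z ≡ B′ z) → census B n ≡ census B′ n
census-cong B B′ zero    B≗B′ = cong (λ b → (if b then 1 else 0) + 0) (B≗B′ [] refl)
census-cong B B′ (suc n) B≗B′ = begin
    census B (suc n)                                             ≡⟨ census-suc B n ⟩
    census (λ z → B (false ∷ z)) n + census (λ z → B (true ∷ z)) n
      ≡⟨ cong₂ _+_ (census-cong _ _ n (λ z eq → B≗B′ (false ∷ z) (cong suc eq)))
                   (census-cong _ _ n (λ z eq → B≗B′ (true ∷ z) (cong suc eq))) ⟩
    census (λ z → B′ (false ∷ z)) n + census (λ z → B′ (true ∷ z)) n ≡⟨ census-suc B′ n ⟨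
    census B′ (suc n)                                            ∎
  where open ≡-Reasoning

census-all : ∀ n → census (λ _ → true) n ≡ 2 ^ n
census-all zero    = refl
census-all (suc n) = trans (census-suc _ n)
  (trans (cong₂ _+_ (census-all n) (census-all n)) (cong (2 ^ n +_) (sym (+-identityʳ (2 ^ n)))))

census-none : ∀ n → census (λ _ → false) n ≡ 0
census-none zero    = refl
census-none (suc n) = trans (census-suc _ n) (cong₂ _+_ (census-none n) (census-none n))

census-complement : ∀ (P : Lang) n → census P n + census (λ z → not (P z)) n ≡ 2 ^ n
census-complement P n = trans (count-complement (allStrings n)) (census-all n)
  where
  count-complement : ∀ xs → count P xs + count (λ z → not (P z)) xs ≡ count (λ _ → true) xs
  count-complement []       = refl
  count-complement (x ∷ xs) with P x
  ... | true  = cong suc (count-complement xs)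
  ... | false = trans (+-suc _ _) (cong suc (count-complement xs))

census-≡ : ∀ y → census (λ z → does (z ≟ₛ y)) (length y) ≡ 1
census-≡ []          = refl
census-≡ (false ∷ y) = trans (census-suc _ (length y)) (cong₂ _+_ (census-≡ y) (census-none (length y)))
census-≡ (true ∷ y)  = trans (census-suc _ (length y)) (cong₂ _+_ (census-none (length y)) (census-≡ y))

census-lexLeq : ∀ y → census (λ z → lexLeq z y) (length y) ≡ suc (val y)
census-lexLeq []          = refl
census-lexLeq (false ∷ y) = trans (census-suc _ (length y))
  (trans (cong₂ _+_ (census-lexLeq y) (census-none (length y))) (+-identityʳ _))
census-lexLeq (true ∷ y)  = trans (census-suc _ (length y))
  (trans (cong₂ _+_ (census-all (length y)) (census-lexLeq y))
         (trans (+-suc _ _) (cong suc (sym (valFrom-1 y)))))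

countUpTo : Lang → ℕ → ℕ
countUpTo B n = count B (concatMap allStrings (upTo n))

countUpTo-suc : ∀ B n → countUpTo B (suc n) ≡ countUpTo B n + census B n
countUpTo-suc B n = begin
    count B (concatMap allStrings (upTo (suc n)))         ≡⟨ cong (λ ns → count B (concatMap allStrings ns)) (upTo-∷ʳ n) ⟨
    count B (concatMap allStrings (upTo n ++ n ∷ []))     ≡⟨ cong (count B) (concatMap-++ allStrings (upTo n) (n ∷ [])) ⟩
    count B (concatMap allStrings (upTo n) ++ allStrings n ++ []) ≡⟨ count-++ B (concatMap allStrings (upTo n)) (allStrings n ++ []) ⟩
    countUpTo B n + count B (allStrings n ++ [])          ≡⟨ cong (λ xs → countUpTo B n + count B xs) (++-identityʳ (allStrings n)) ⟩
    countUpTo B n + census B n                            ∎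
  where open ≡-Reasoning

countUpTo-cong : ∀ B B′ n → (∀ z → length z < n → B z ≡ B′ z) → countUpTo B n ≡ countUpTo B′ n
countUpTo-cong B B′ zero    B≗B′ = refl
countUpTo-cong B B′ (suc n) B≗B′ = begin
    countUpTo B (suc n)          ≡⟨ countUpTo-suc B n ⟩
    countUpTo B n + census B n
      ≡⟨ cong₂ _+_ (countUpTo-cong B B′ n (λ z l → B≗B′ z (m<n⇒m<1+n l)))
                   (census-cong B B′ n (λ z eq → B≗B′ z (s≤s (≤-reflexive eq)))) ⟩
    countUpTo B′ n + census B′ n ≡⟨ countUpTo-suc B′ n ⟨
    countUpTo B′ (suc n)         ∎
  where open ≡-Reasoning

stdLeq-shorter : ∀ z x → length z < length x → stdLeq z x ≡ true
stdLeq-shorter z x l rewrite dec-true (length z <? length x) l = refl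

stdLeq-sameLength : ∀ z x → length z ≡ length x → stdLeq z x ≡ lexLeq z x
stdLeq-sameLength z x eq
  rewrite eq | dec-false (length x <? length x) (<-irrefl refl) | dec-true (length x ≟ length x) refl = refl

rank-split : ∀ C x → rank C x ≡ countUpTo C (length x) + census (λ z → if lexLeq z x then C z else false) (length x)
rank-split C x = trans (countUpTo-suc C≤x (length x))
  (cong₂ _+_ (countUpTo-cong C≤x C (length x) (λ z l → cong (λ b → if b then C z else false) (stdLeq-shorter z x l)))
             (census-cong C≤x _ (length x) (λ z eq → cong (λ b → if b then C z else false) (stdLeq-sameLength z x eq))))
  where
  C≤x : Lang
  C≤x z = if stdLeq z x then C z else false

startsWith1 : Lang
startsWith1 (true ∷ _) = true
startsWith1 _          = false

suc-countUpTo-startsWith1 : ∀ k → suc (countUpTo startsWith1 (suc k)) ≡ 2 ^ k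
suc-countUpTo-startsWith1 zero    = refl
suc-countUpTo-startsWith1 (suc k) = begin
    suc (countUpTo startsWith1 (suc (suc k)))                 ≡⟨ cong suc (countUpTo-suc startsWith1 (suc k)) ⟩
    suc (countUpTo startsWith1 (suc k) + census startsWith1 (suc k))
      ≡⟨ cong (λ c → suc (countUpTo startsWith1 (suc k) + c)) (census-suc startsWith1 k) ⟩
    suc (countUpTo startsWith1 (suc k) + (census (λ _ → false) k + census (λ _ → true) k))
      ≡⟨ cong₂ (λ a b → a + (b + census (λ _ → true) k)) (suc-countUpTo-startsWith1 k) (census-none k) ⟩
    2 ^ k + census (λ _ → true) k                             ≡⟨ cong (2 ^ k +_) (census-all k) ⟩
    2 ^ k + 2 ^ k                                             ≡⟨ cong (2 ^ k +_) (+-identityʳ (2 ^ k)) ⟨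
    2 ^ suc k                                                 ∎
  where open ≡-Reasoning

rank-startsWith1-1∷ : ∀ y → rank startsWith1 (true ∷ y) ≡ valFrom 1 y
rank-startsWith1-1∷ y = begin
    rank startsWith1 (true ∷ y)
      ≡⟨ rank-split startsWith1 (true ∷ y) ⟩
    countUpTo startsWith1 (suc n) + census (λ z → if lexLeq z (true ∷ y) then startsWith1 z else false) (suc n)
      ≡⟨ cong (countUpTo startsWith1 (suc n) +_) (census-suc _ n) ⟩
    countUpTo startsWith1 (suc n) + (census (λ _ → false) n + census (λ z → if lexLeq z y then true else false) n)
      ≡⟨ cong₂ (λ a b → countUpTo startsWith1 (suc n) + (a + b)) (census-none n)
               (census-cong _ _ n (λ z _ → if-true-false (lexLeq z y))) ⟩
    countUpTo startsWith1 (suc n) + census (λ z → lexLeq z y) n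
      ≡⟨ cong (countUpTo startsWith1 (suc n) +_) (census-lexLeq y) ⟩
    countUpTo startsWith1 (suc n) + suc (val y)
      ≡⟨ +-suc _ (val y) ⟩
    suc (countUpTo startsWith1 (suc n)) + val y
      ≡⟨ cong (_+ val y) (suc-countUpTo-startsWith1 n) ⟩
    2 ^ n + val y
      ≡⟨ valFrom-1 y ⟨
    valFrom 1 y
      ∎
  where
  open ≡-Reasoning
  n : ℕ
  n = length y
  if-true-false : ∀ b → (if b then true else false) ≡ b
  if-true-false false = refl
  if-true-false true  = refl

rank-startsWith1-0∷ : ∀ y → rank startsWith1 (false ∷ y) ≡ val (replicate (length y) true)
rank-startsWith1-0∷ y = suc-injective (begin
    suc (rank startsWith1 (false ∷ y))
      ≡⟨ cong suc (rank-split startsWith1 (false ∷ y)) ⟩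
    suc (countUpTo startsWith1 (suc n) + census (λ z → if lexLeq z (false ∷ y) then startsWith1 z else false) (suc n))
      ≡⟨ cong (λ c → suc (countUpTo startsWith1 (suc n) + c)) (census-suc _ n) ⟩
    suc (countUpTo startsWith1 (suc n) + (census (λ z → if lexLeq z y then false else false) n + census (λ _ → false) n))
      ≡⟨ cong (λ c → suc (countUpTo startsWith1 (suc n) + (c + census (λ _ → false) n)))
              (census-cong _ _ n (λ z _ → if-false-false (lexLeq z y))) ⟩
    suc (countUpTo startsWith1 (suc n) + (census (λ _ → false) n + census (λ _ → false) n))
      ≡⟨ cong (λ c → suc (countUpTo startsWith1 (suc n) + (c + c))) (census-none n) ⟩
    suc (countUpTo startsWith1 (suc n) + 0)
      ≡⟨ cong suc (+-identityʳ _) ⟩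
    suc (countUpTo startsWith1 (suc n))
      ≡⟨ suc-countUpTo-startsWith1 n ⟩
    2 ^ n
      ≡⟨ suc-val-ones n ⟨
    suc (val (replicate n true))
      ∎)
  where
  open ≡-Reasoning
  n : ℕ
  n = length y
  if-false-false : ∀ b → (if b then false else false) ≡ false
  if-false-false false = refl
  if-false-false true  = refl

rankOutput : Str → Str
rankOutput []          = []
rankOutput (true ∷ y)  = true ∷ y
rankOutput (false ∷ y) = replicate (length y) true

bin-rank-startsWith1 : ∀ x → bin (rank startsWith1 x) ≡ rankOutput x
bin-rank-startsWith1 []          = refl
bin-rank-startsWith1 (true ∷ y)  = trans (cong bin (rank-startsWith1-1∷ y)) (bin-valFrom-1 y)
bin-rank-startsWith1 (false ∷ y) = trans (cong bin (rank-startsWith1-0∷ y)) (bin-val-ones (length y))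

dropLast : Str → Str
dropLast y = reverse (drop 1 (reverse y))

swapWith : (answer first : Bool) → Str → Str
swapWith true  true  y = false ∷ (y ++ false ∷ [])
swapWith true  false y = true ∷ dropLast y
swapWith false b     y = b ∷ y

swap : Lang → Str → Str
swap X []      = []
swap X (b ∷ y) = swapWith (X (b ∷ y)) b y

dropLast-∷ʳ : ∀ y b → dropLast (y ∷ʳ b) ≡ y
dropLast-∷ʳ y b = trans (cong (λ u → reverse (drop 1 u)) (reverse-++ y (b ∷ []))) (reverse-involutive y)

lastIs0 : Str → Bool
lastIs0 z with reverse z
... | false ∷ _ = true
... | _         = false

lastIs0-∷ʳ : ∀ y → lastIs0 (y ∷ʳ false) ≡ true
lastIs0-∷ʳ y rewrite reverse-++ y (false ∷ []) = refl

lastIs0⇒∷ʳ : ∀ z → lastIs0 z ≡ true → dropLast z ∷ʳ false ≡ z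
lastIs0⇒∷ʳ z last0 with reverse z in rev
... | false ∷ r = begin
    reverse (drop 1 (false ∷ r)) ∷ʳ false ≡⟨ unfold-reverse false r ⟨
    reverse (false ∷ r)                  ≡⟨ cong reverse rev ⟨
    reverse (reverse z)                  ≡⟨ reverse-involutive z ⟩
    z                                    ∎
  where open ≡-Reasoning

length-dropLast : ∀ z → lastIs0 z ≡ true → suc (length (dropLast z)) ≡ length z
length-dropLast z last0 = begin
    suc (length (dropLast z))         ≡⟨ +-comm 1 _ ⟩
    length (dropLast z) + 1           ≡⟨ length-++ (dropLast z) ⟨
    length (dropLast z ∷ʳ false)      ≡⟨ cong length (lastIs0⇒∷ʳ z last0) ⟩
    length z                          ∎
  where open ≡-Reasoning

Swapped : (Str → Bool) → Lang
Swapped P []          = false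
Swapped P (true ∷ y)  = P y
Swapped P (false ∷ z) = lastIs0 z ∧ P (dropLast z)

-- the y with q = 1y or q = 0y0, if any
candidate : Str → Str
candidate []          = []
candidate (true ∷ y)  = y
candidate (false ∷ z) = dropLast z

Swapped-cong : ∀ P P′ q → P (candidate q) ≡ P′ (candidate q) → Swapped P q ≡ Swapped P′ q
Swapped-cong P P′ []          _  = refl
Swapped-cong P P′ (true ∷ y)  eq = eq
Swapped-cong P P′ (false ∷ z) eq = cong (lastIs0 z ∧_) eq

swap-involutive : ∀ P x → swap (Swapped P) (swap (Swapped P) x) ≡ x
swap-involutive P []         = refl
swap-involutive P (true ∷ y) with P y in Py
... | false = cong (λ a → swapWith a true y) Py
... | true  = begin
    swapWith (lastIs0 (y ∷ʳ false) ∧ P (dropLast (y ∷ʳ false))) false (y ∷ʳ false)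
      ≡⟨ cong (λ a → swapWith a false (y ∷ʳ false)) (cong₂ _∧_ (lastIs0-∷ʳ y) (trans (cong P (dropLast-∷ʳ y false)) Py)) ⟩
    true ∷ dropLast (y ∷ʳ false)
      ≡⟨ cong (true ∷_) (dropLast-∷ʳ y false) ⟩
    true ∷ y ∎
  where open ≡-Reasoning
swap-involutive P (false ∷ z) = swapped-twice (lastIs0 z) (P (dropLast z)) refl refl
  where
  swapped-twice : ∀ l p → lastIs0 z ≡ l → P (dropLast z) ≡ p → swap (Swapped P) (swapWith (l ∧ p) false z) ≡ false ∷ z
  swapped-twice false _     l≡ _  = cong (λ a → swapWith a false z) (cong (_∧ P (dropLast z)) l≡)
  swapped-twice true  false l≡ p≡ = cong (λ a → swapWith a false z) (cong₂ _∧_ l≡ p≡)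
  swapped-twice true  true  l≡ p≡ = trans (cong (λ a → swapWith a true (dropLast z)) p≡) (cong (false ∷_) (lastIs0⇒∷ʳ z l≡))

length-dropLast≤ : ∀ z → length (dropLast z) ≤ length z
length-dropLast≤ z = begin
    length (reverse (drop 1 (reverse z))) ≡⟨ length-reverse (drop 1 (reverse z)) ⟩
    length (drop 1 (reverse z))           ≡⟨ length-drop 1 (reverse z) ⟩
    length (reverse z) ∸ 1                ≤⟨ m∸n≤m _ 1 ⟩
    length (reverse z)                    ≡⟨ length-reverse z ⟩
    length z                              ∎
  where open ≤-Reasoning

length-candidate : ∀ q n → length q ≤ suc n → length (candidate q) ≤ n
length-candidate []          n _         = z≤n
length-candidate (true ∷ y)  n (s≤s y≤n) = y≤n
length-candidate (false ∷ z) n (s≤s |z|≤n) = ≤-trans (length-dropLast≤ z) |z|≤n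

double≤suc^5 : ∀ n → n + n ≤ suc n ^ 5
double≤suc^5 n = begin
    n + n                 ≤⟨ m≤m+n (n + n) (n * n) ⟩
    (n + n) + n * n       ≤⟨ n≤1+n _ ⟩
    suc ((n + n) + n * n) ≡⟨ square n ⟨
    suc n ^ 2             ≤⟨ ^-monoʳ-≤ (suc n) {2} {5} (s≤s (s≤s z≤n)) ⟩
    suc n ^ 5             ∎
  where
  square : ∀ n → (1 + n) * ((1 + n) * 1) ≡ 1 + ((n + n) + n * n)
  square = solve-∀
  open ≤-Reasoning

cellsFrom : List Sym → Str → Tape
cellsFrom ls []      = tape ls blank []
cellsFrom ls (c ∷ z) = tape ls (symOf c) (map symOf z)

moveR-onto : ∀ ls h z → moveT R (tape ls h (map symOf z)) ≡ cellsFrom (h ∷ ls) z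
moveR-onto ls h []      = refl
moveR-onto ls h (_ ∷ _) = refl

-- The head is on the first symbol of w, which lists the cells to the right of the cell-0 blank in
-- reverse order; at the blank itself when w is empty.
behind : Str → List Sym → Tape
behind []      r = tape [] blank r
behind (c ∷ w) r = tape (map symOf w ++ blank ∷ []) (symOf c) r

moveL-behind : ∀ w h r → moveT L (tape (map symOf w ++ blank ∷ []) h r) ≡ behind w (h ∷ r)
moveL-behind []      h r = refl
moveL-behind (_ ∷ _) h r = refl

symsToStr-map : ∀ z r → symsToStr (map symOf z ++ blank ∷ r) ≡ z
symsToStr-map []          r = refl
symsToStr-map (false ∷ z) r = cong (false ∷_) (symsToStr-map z r)
symsToStr-map (true ∷ z)  r = cong (true ∷_) (symsToStr-map z r)

symsToStr-map′ : ∀ z → symsToStr (map symOf z) ≡ z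
symsToStr-map′ []          = refl
symsToStr-map′ (false ∷ z) = cong (false ∷_) (symsToStr-map′ z)
symsToStr-map′ (true ∷ z)  = cong (true ∷_) (symsToStr-map′ z)

symsToStr-symOf : ∀ b z r → symsToStr (symOf b ∷ map symOf z ++ blank ∷ r) ≡ b ∷ z
symsToStr-symOf false z r = cong (false ∷_) (symsToStr-map z r)
symsToStr-symOf true  z r = cong (true ∷_) (symsToStr-map z r)

module SwapMachine where

  data State : Set where
    starting deleting finished : State
    copying rewinding          : Bool → State
    answered                   : (answer first : Bool) → State

  ⌜_⌝ : State → Fin 11
  ⌜ starting ⌝             = # 0
  ⌜ copying false ⌝        = # 1
  ⌜ copying true ⌝         = # 2
  ⌜ answered false false ⌝ = # 3
  ⌜ answered false true ⌝  = # 4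
  ⌜ answered true false ⌝  = # 5
  ⌜ answered true true ⌝   = # 6
  ⌜ deleting ⌝             = # 7
  ⌜ rewinding false ⌝      = # 8
  ⌜ rewinding true ⌝       = # 9
  ⌜ finished ⌝             = # 10

  stateOf : Fin 11 → State
  stateOf = lookup (starting ∷ copying false ∷ copying true ∷ answered false false ∷ answered false true
                   ∷ answered true false ∷ answered true true ∷ deleting ∷ rewinding false ∷ rewinding true
                   ∷ finished ∷ [])

  -- Cell 0 is blanked and serves as an end marker; the first input bit is kept in the state and
  -- written back there at the end.
  δ : State → Sym → Sym → Action 11
  δ starting             blank _ = halt
  δ starting             s0    _ = step ⌜ copying false ⌝ blank R s0 R
  δ starting             s1    _ = step ⌜ copying true ⌝ blank R s1 R
  δ (copying b)          blank _ = query ⌜ answered true b ⌝ ⌜ answered false b ⌝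
  δ (copying b)          s     _ = step ⌜ copying b ⌝ s R s R
  δ (answered false b)   _     _ = step ⌜ rewinding b ⌝ blank L blank S
  δ (answered true true) _     _ = step ⌜ rewinding false ⌝ s0 L blank S
  δ (answered true false) _    _ = step ⌜ deleting ⌝ blank L blank S
  δ deleting             _     _ = step ⌜ rewinding true ⌝ blank L blank S
  δ (rewinding b)        blank _ = step ⌜ finished ⌝ (symOf b) S blank S
  δ (rewinding b)        s     _ = step ⌜ rewinding b ⌝ s L blank S
  δ finished             _     _ = halt

  machine : OTM
  machine = record { states = 11 ; start = ⌜ starting ⌝ ; δ = λ q → δ (stateOf q) }

  at : State → Tape → Tape → Config machine
  at s w q = cfg ⌜ s ⌝ w q

  -- the work tape once the input tail (reversed: w) has been scanned
  scanned : Str → Tape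
  scanned w = tape (map symOf w ++ blank ∷ []) blank []

  queryTape : Bool → Str → Tape
  queryTape b y = tape (map symOf (reverse y) ++ symOf b ∷ []) blank []

  readTape-queryTape : ∀ b y → readTape (queryTape b y) ≡ b ∷ y
  readTape-queryTape b y = begin
      symsToStr (reverse (map symOf (reverse y) ++ symOf b ∷ []) ++ blank ∷ [])
        ≡⟨ cong (λ u → symsToStr (u ++ blank ∷ [])) (reverse-++ (map symOf (reverse y)) (symOf b ∷ [])) ⟩
      symsToStr (symOf b ∷ reverse (map symOf (reverse y)) ++ blank ∷ [])
        ≡⟨ cong (λ u → symsToStr (symOf b ∷ u ++ blank ∷ [])) (reverse-map symOf (reverse y)) ⟨
      symsToStr (symOf b ∷ map symOf (reverse (reverse y)) ++ blank ∷ [])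
        ≡⟨ cong (λ u → symsToStr (symOf b ∷ map symOf u ++ blank ∷ [])) (reverse-involutive y) ⟩
      symsToStr (symOf b ∷ map symOf y ++ blank ∷ [])
        ≡⟨ symsToStr-symOf b y [] ⟩
      b ∷ y ∎
    where open ≡-Reasoning

  module _ (X : Lang) where

    copy-loop : ∀ b z w →
      runFor X machine (length z) (at (copying b) (cellsFrom (map symOf w ++ blank ∷ []) z) (tape (map symOf w ++ symOf b ∷ []) blank []))
      ≡ at (copying b) (scanned (z ʳ++ w)) (tape (map symOf (z ʳ++ w) ++ symOf b ∷ []) blank [])
    copy-loop false []          w = refl
    copy-loop true  []          w = refl
    copy-loop false (false ∷ z) w =
      trans (cong (λ T → runFor X machine (length z) (at (copying false) T _)) (moveR-onto _ s0 z)) (copy-loop false z (false ∷ w))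
    copy-loop false (true ∷ z)  w =
      trans (cong (λ T → runFor X machine (length z) (at (copying false) T _)) (moveR-onto _ s1 z)) (copy-loop false z (true ∷ w))
    copy-loop true  (false ∷ z) w =
      trans (cong (λ T → runFor X machine (length z) (at (copying true) T _)) (moveR-onto _ s0 z)) (copy-loop true z (false ∷ w))
    copy-loop true  (true ∷ z)  w =
      trans (cong (λ T → runFor X machine (length z) (at (copying true) T _)) (moveR-onto _ s1 z)) (copy-loop true z (true ∷ w))

    swap-copies : ∀ b y → runFor X machine (suc (length y)) (initConfig machine (b ∷ y))
                          ≡ at (copying b) (scanned (reverse y)) (queryTape b y)
    swap-copies false y =
      trans (cong (λ T → runFor X machine (length y) (at (copying false) T _)) (moveR-onto [] blank y)) (copy-loop false y [])
    swap-copies true  y =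
      trans (cong (λ T → runFor X machine (length y) (at (copying true) T _)) (moveR-onto [] blank y)) (copy-loop true y [])

    swap-queries : ∀ b y w → runFor X machine 1 (at (copying b) (scanned w) (queryTape b y))
                             ≡ at (answered (X (b ∷ y)) b) (scanned w) emptyTape
    swap-queries b y w = trans (queried b) (cong (λ a → at (answered a b) (scanned w) emptyTape) (cong X (readTape-queryTape b y)))
      where
      branch : ∀ a b → (if a then ⌜ answered true b ⌝ else ⌜ answered false b ⌝) ≡ ⌜ answered a b ⌝
      branch false _ = refl
      branch true  _ = refl
      queried : ∀ b → runFor X machine 1 (at (copying b) (scanned w) (queryTape b y))
                      ≡ at (answered (X (readTape (queryTape b y))) b) (scanned w) emptyTape
      queried false = cong (λ q → cfg q (scanned w) emptyTape) (branch (X (readTape (queryTape false y))) false)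
      queried true  = cong (λ q → cfg q (scanned w) emptyTape) (branch (X (readTape (queryTape true y))) true)

    swap-rewinds : ∀ b w r → HaltsWithin X machine (at (rewinding b) (behind w r) emptyTape) (suc (length w))
                                        (symsToStr (symOf b ∷ map symOf (reverse w) ++ r))
    swap-rewinds b []      r = halts-after 1 (writes-bit b) (halts-now (at finished (tape [] (symOf b) r) emptyTape) refl)
      where
      writes-bit : ∀ b → runFor X machine 1 (at (rewinding b) (behind [] r) emptyTape) ≡ at finished (tape [] (symOf b) r) emptyTape
      writes-bit false = refl
      writes-bit true  = refl
    swap-rewinds b (c ∷ w) r =
      halts-after 1 (step-left b c) (halts-cast (cong (λ u → symsToStr (symOf b ∷ u)) (shift c w r)) (swap-rewinds b w (symOf c ∷ r)))
      where
      step-left : ∀ b c → runFor X machine 1 (at (rewinding b) (behind (c ∷ w) r) emptyTape)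
                          ≡ at (rewinding b) (behind w (symOf c ∷ r)) emptyTape
      step-left false false = cong (λ T → at (rewinding false) T emptyTape) (moveL-behind w s0 r)
      step-left false true  = cong (λ T → at (rewinding false) T emptyTape) (moveL-behind w s1 r)
      step-left true  false = cong (λ T → at (rewinding true) T emptyTape) (moveL-behind w s0 r)
      step-left true  true  = cong (λ T → at (rewinding true) T emptyTape) (moveL-behind w s1 r)
      shift : ∀ c w r → map symOf (reverse w) ++ symOf c ∷ r ≡ map symOf (reverse (c ∷ w)) ++ r
      shift c w r = begin
          map symOf (reverse w) ++ symOf c ∷ r          ≡⟨ ++-assoc (map symOf (reverse w)) (symOf c ∷ []) r ⟨
          (map symOf (reverse w) ++ symOf c ∷ []) ++ r  ≡⟨ cong (_++ r) (map-++ symOf (reverse w) (c ∷ [])) ⟨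
          map symOf (reverse w ++ c ∷ []) ++ r          ≡⟨ cong (λ u → map symOf u ++ r) (unfold-reverse c w) ⟨
          map symOf (reverse (c ∷ w)) ++ r              ∎
        where open ≡-Reasoning

    swap-finishes : ∀ a b w → HaltsWithin X machine (at (answered a b) (scanned w) emptyTape) (3 + length w) (swapWith a b (reverse w))
    swap-finishes false b w = halts-mono (n≤1+n _)
      (halts-after 1 (first-step b)
      (halts-cast (symsToStr-symOf b (reverse w) []) (swap-rewinds b w (blank ∷ []))))
      where
      first-step : ∀ b → runFor X machine 1 (at (answered false b) (scanned w) emptyTape)
                         ≡ at (rewinding b) (behind w (blank ∷ [])) emptyTape
      first-step false = cong (λ T → at (rewinding false) T emptyTape) (moveL-behind w blank [])
      first-step true  = cong (λ T → at (rewinding true) T emptyTape) (moveL-behind w blank [])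
    swap-finishes true true w = halts-mono (n≤1+n _)
      (halts-after 1 (cong (λ T → at (rewinding false) T emptyTape) (moveL-behind w s0 []))
      (halts-cast (appended (reverse w)) (swap-rewinds false w (s0 ∷ []))))
      where
      appended : ∀ z → symsToStr (s0 ∷ map symOf z ++ s0 ∷ []) ≡ false ∷ z ++ false ∷ []
      appended z = cong (false ∷_) (trans (cong symsToStr (sym (map-++ symOf z (false ∷ [])))) (symsToStr-map′ (z ++ false ∷ [])))
    swap-finishes true false [] =
      halts-after 1 refl (halts-after 1 refl (halts-after 1 refl (halts-now (at finished (tape [] s1 (blank ∷ [])) emptyTape) refl)))
    swap-finishes true false (c ∷ w) = halts-mono (+-monoʳ-≤ 3 (n≤1+n (length w)))
      (halts-after 1 refl
      (halts-after 1 (cong (λ T → at (rewinding true) T emptyTape) (moveL-behind w blank (blank ∷ [])))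
      (halts-cast (trans (symsToStr-symOf true (reverse w) _)
                         (cong (λ u → true ∷ reverse (drop 1 u)) (sym (reverse-involutive (c ∷ w)))))
                  (swap-rewinds true w (blank ∷ blank ∷ [])))))

    swapTime : ℕ → ℕ
    swapTime n = suc n + (1 + (3 + n))

    swap-halts : ∀ b y → HaltsWithin X machine (initConfig machine (b ∷ y)) (swapTime (length y)) (swap X (b ∷ y))
    swap-halts b y =
      halts-after (suc (length y)) (swap-copies b y)
      (halts-after 1 (swap-queries b y (reverse y))
      (halts-mono (≤-reflexive (cong (3 +_) (length-reverse y)))
      (halts-cast (cong (swapWith (X (b ∷ y)) b) (reverse-involutive y))
      (swap-finishes (X (b ∷ y)) b (reverse y)))))

  swap-FP : ∀ X → FP X (swap X)
  swap-FP X = machine , 5 , computesIn-byHalting 5 time halts time≤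
    where
    time : Str → ℕ
    time []      = 0
    time (_ ∷ y) = swapTime X (length y)
    halts : ∀ x → HaltsWithin X machine (initConfig machine x) (time x) (swap X x)
    halts []      = halts-now (initConfig machine []) refl
    halts (b ∷ y) = swap-halts X b y
    time≤ : ∀ x → time x ≤ length x ^ 5 + 5
    time≤ []      = z≤n
    time≤ (_ ∷ y) = ≤-trans (≤-reflexive (regroup (length y))) (+-monoˡ-≤ 5 (double≤suc^5 (length y)))
      where
      regroup : ∀ n → suc n + (1 + (3 + n)) ≡ (n + n) + 5
      regroup = solve-∀

reverse-replicate : ∀ {A : Set} n (a : A) → reverse (replicate n a) ≡ replicate n a
reverse-replicate zero    a = refl
reverse-replicate (suc n) a = begin
    reverse (a ∷ replicate n a)   ≡⟨ unfold-reverse a (replicate n a) ⟩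
    reverse (replicate n a) ∷ʳ a  ≡⟨ cong (_∷ʳ a) (reverse-replicate n a) ⟩
    replicate n a ∷ʳ a            ≡⟨ replicate-∷ʳ n ⟩
    a ∷ replicate n a             ∎
  where
  open ≡-Reasoning
  replicate-∷ʳ : ∀ n → replicate n a ∷ʳ a ≡ a ∷ replicate n a
  replicate-∷ʳ zero    = refl
  replicate-∷ʳ (suc n) = cong (a ∷_) (replicate-∷ʳ n)

module RankMachine where

  data State : Set where
    starting overwriting erasing finished : State

  ⌜_⌝ : State → Fin 4
  ⌜ starting ⌝    = # 0
  ⌜ overwriting ⌝ = # 1
  ⌜ erasing ⌝     = # 2
  ⌜ finished ⌝    = # 3

  stateOf : Fin 4 → State
  stateOf = lookup (starting ∷ overwriting ∷ erasing ∷ finished ∷ [])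

  -- On 0y, overwrite the input by 1^(|y|+1), then erase the last 1; other inputs are their own output.
  δ : State → Sym → Sym → Action 4
  δ starting    s0    _ = step ⌜ overwriting ⌝ s1 R blank S
  δ starting    _     _ = halt
  δ overwriting blank _ = step ⌜ erasing ⌝ blank L blank S
  δ overwriting _     _ = step ⌜ overwriting ⌝ s1 R blank S
  δ erasing     _     _ = step ⌜ finished ⌝ blank S blank S
  δ finished    _     _ = halt

  machine : OTM
  machine = record { states = 4 ; start = ⌜ starting ⌝ ; δ = λ q → δ (stateOf q) }

  module _ (X : Lang) where

    overwrite-loop : ∀ z k → runFor X machine (length z) (cfg ⌜ overwriting ⌝ (cellsFrom (replicate k s1) z) emptyTape)
                             ≡ cfg ⌜ overwriting ⌝ (tape (replicate (k + length z) s1) blank []) emptyTape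
    overwrite-loop []      k = cong (λ j → cfg ⌜ overwriting ⌝ (tape (replicate j s1) blank []) emptyTape) (sym (+-identityʳ k))
    overwrite-loop (c ∷ z) k = begin
        runFor X machine (suc (length z)) (cfg ⌜ overwriting ⌝ (cellsFrom (replicate k s1) (c ∷ z)) emptyTape)
          ≡⟨ overwrite-step c ⟩
        runFor X machine (length z) (cfg ⌜ overwriting ⌝ (moveT R (tape (replicate k s1) s1 (map symOf z))) emptyTape)
          ≡⟨ cong (λ T → runFor X machine (length z) (cfg ⌜ overwriting ⌝ T emptyTape)) (moveR-onto (replicate k s1) s1 z) ⟩
        runFor X machine (length z) (cfg ⌜ overwriting ⌝ (cellsFrom (replicate (suc k) s1) z) emptyTape)
          ≡⟨ overwrite-loop z (suc k) ⟩
        cfg ⌜ overwriting ⌝ (tape (replicate (suc k + length z) s1) blank []) emptyTape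
          ≡⟨ cong (λ j → cfg ⌜ overwriting ⌝ (tape (replicate j s1) blank []) emptyTape) (sym (+-suc k (length z))) ⟩
        cfg ⌜ overwriting ⌝ (tape (replicate (k + suc (length z)) s1) blank []) emptyTape
          ∎
      where
      open ≡-Reasoning
      overwrite-step : ∀ c → runFor X machine (suc (length z)) (cfg ⌜ overwriting ⌝ (cellsFrom (replicate k s1) (c ∷ z)) emptyTape)
                             ≡ runFor X machine (length z) (cfg ⌜ overwriting ⌝ (moveT R (tape (replicate k s1) s1 (map symOf z))) emptyTape)
      overwrite-step false = refl
      overwrite-step true  = refl

    rank-halts-0∷ : ∀ y → HaltsWithin X machine (initConfig machine (false ∷ y)) (1 + (length y + 2)) (replicate (length y) true)
    rank-halts-0∷ y =
      halts-after 1 (cong (λ T → cfg ⌜ overwriting ⌝ T emptyTape) (moveR-onto [] s1 y))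
      (halts-after (length y) (overwrite-loop y 1)
      (halts-after 1 refl (halts-after 1 refl (halts-cast ones (halts-now _ refl)))))
      where
      ones : symsToStr (reverse (replicate (length y) s1) ++ blank ∷ blank ∷ []) ≡ replicate (length y) true
      ones = trans (cong (λ l → symsToStr (l ++ blank ∷ blank ∷ []))
                         (trans (reverse-replicate (length y) s1) (sym (map-replicate symOf (length y) true))))
                   (symsToStr-map (replicate (length y) true) (blank ∷ []))

  rank-FP : ∀ X → RankableIn X startsWith1
  rank-FP X = machine , 5 , computesIn-byHalting 5 time halts time≤
    where
    time : Str → ℕ
    time (false ∷ y) = 1 + (length y + 2)
    time _           = 0
    halts : ∀ x → HaltsWithin X machine (initConfig machine x) (time x) (bin (rank startsWith1 x))
    halts []          = halts-now (initConfig machine []) refl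
    halts (true ∷ y)  = halts-cast (trans (cong (true ∷_) (symsToStr-map′ y)) (sym (bin-rank-startsWith1 (true ∷ y))))
                                   (halts-now (initConfig machine (true ∷ y)) refl)
    halts (false ∷ y) = halts-cast (sym (bin-rank-startsWith1 (false ∷ y))) (rank-halts-0∷ X y)
    time≤ : ∀ x → time x ≤ length x ^ 5 + 5
    time≤ []          = z≤n
    time≤ (true ∷ _)  = z≤n
    time≤ (false ∷ y) = ≤-trans (≤-reflexive (+-comm 1 (length y + 2))) (≤-trans (≤-reflexive (+-assoc (length y) 2 1))
                          (+-mono-≤ (≤-trans (m≤m+n (length y) (length y)) (double≤suc^5 (length y))) (s≤s (s≤s (s≤s z≤n)))))

swapped-scalable : ∀ P → Scalable (Swapped P) (λ x → startsWith1 (swap (Swapped P) x))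
swapped-scalable P = iso , startsWith1 , (λ _ → refl) , RankMachine.rank-FP (Swapped P)
  where
  iso : PIso (Swapped P)
  iso = record { φ = swap (Swapped P) ; ψ = swap (Swapped P)
               ; ψ∘φ = swap-involutive P ; φ∘ψ = swap-involutive P
               ; φ-FP = SwapMachine.swap-FP (Swapped P) ; ψ-FP = SwapMachine.swap-FP (Swapped P) }

queries : Lang → (M : OTM) → ℕ → Config M → List Str
queries X M zero    c            = []
queries X M (suc t) (cfg q w qt) with OTM.δ M q (here w) (here qt)
... | halt             = []
... | query qy qn      = readTape qt ∷ queries X M t (cfg (if X (readTape qt) then qy else qn) w emptyTape)
... | step q′ a m b m′ = queries X M t (cfg q′ (moveT m (writeT a w)) (moveT m′ (writeT b qt)))

runFor-oracle-cong : ∀ X Y M t (c : Config M) → All (λ s → X s ≡ Y s) (queries X M t c) → runFor X M t c ≡ runFor Y M t c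
runFor-oracle-cong X Y M zero    c            _ = refl
runFor-oracle-cong X Y M (suc t) (cfg q w qt) agree with OTM.δ M q (here w) (here qt)
... | halt             = refl
... | step q′ a m b m′ = runFor-oracle-cong X Y M t _ agree
... | query qy qn with agree
...   | X≡Y ∷ rest = trans (runFor-oracle-cong X Y M t _ rest)
                           (cong (λ a → runFor Y M t (cfg (if a then qy else qn) w emptyTape)) X≡Y)

length-queries : ∀ X M t (c : Config M) → length (queries X M t c) ≤ t
length-queries X M zero    c            = z≤n
length-queries X M (suc t) (cfg q w qt) with OTM.δ M q (here w) (here qt)
... | halt             = z≤n
... | query qy qn      = s≤s (length-queries X M t _)
... | step q′ a m b m′ = ≤-trans (length-queries X M t _) (n≤1+n t)

private
  span : Tape → ℕ
  span (tape l _ r) = length l + length r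

  span-moveT-writeT : ∀ m a T → span (moveT m (writeT a T)) ≤ suc (span T)
  span-moveT-writeT L a (tape []      h r) = n≤1+n _
  span-moveT-writeT L a (tape (_ ∷ l) h r) = ≤-trans (≤-reflexive (+-suc (length l) (length r))) (n≤1+n _)
  span-moveT-writeT R a (tape l h [])      = ≤-refl
  span-moveT-writeT R a (tape l h (_ ∷ r)) = s≤s (+-monoʳ-≤ (length l) (n≤1+n _))
  span-moveT-writeT S a T                  = n≤1+n _

  length-symsToStr : ∀ xs → length (symsToStr xs) ≤ length xs
  length-symsToStr []           = z≤n
  length-symsToStr (blank ∷ _)  = z≤n
  length-symsToStr (s0 ∷ xs)    = s≤s (length-symsToStr xs)
  length-symsToStr (s1 ∷ xs)    = s≤s (length-symsToStr xs)

  length-readTape : ∀ T → length (readTape T) ≤ suc (span T)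
  length-readTape (tape l h r) = ≤-trans (length-symsToStr (reverse l ++ h ∷ r)) (≤-reflexive (begin
      length (reverse l ++ h ∷ r)      ≡⟨ length-++ (reverse l) ⟩
      length (reverse l) + suc (length r) ≡⟨ cong (_+ suc (length r)) (length-reverse l) ⟩
      length l + suc (length r)        ≡⟨ +-suc (length l) (length r) ⟩
      suc (length l + length r)        ∎))
    where open ≡-Reasoning

-- The query tape grows by at most one cell per step.
length-queries-bounded : ∀ X M t (c : Config M) → All (λ s → length s ≤ suc (span (Config.qtape c) + t)) (queries X M t c)
length-queries-bounded X M zero    c            = []
length-queries-bounded X M (suc t) (cfg q w qt) with OTM.δ M q (here w) (here qt)
... | halt             = []
... | query qy qn      = ≤-trans (length-readTape qt) (s≤s (m≤m+n _ _))
                       ∷ All.map (λ s≤ → ≤-trans s≤ (s≤s (≤-trans (n≤1+n t) (m≤n+m _ _)))) (length-queries-bounded X M t _)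
... | step q′ a m b m′ =
  All.map (λ s≤ → ≤-trans s≤ (s≤s (≤-trans (+-monoˡ-≤ t (span-moveT-writeT m′ b qt)) (≤-reflexive (sym (+-suc _ t))))))
          (length-queries-bounded X M t _)

queries-from-start : ∀ X M t x → All (λ s → length s ≤ suc t) (queries X M t (initConfig M x))
queries-from-start X M t x = length-queries-bounded X M t (initConfig M x)

-- Decoders that return the unread rest of the string, and their inverses in continuation style.

Parser : Set → Set
Parser A = Str → A × Str

Parses : {A : Set} → Parser A → (A → Str → Str) → Set
Parses p encode = ∀ a r → p (encode a r) ≡ (a , r)

infixl 4 _<*>_ _<$>_

pure : {A : Set} → A → Parser A
pure a w = a , w

_<*>_ : {A B : Set} → Parser (A → B) → Parser A → Parser B
(pf <*> pa) w = proj₁ (pf w) (proj₁ (pa (proj₂ (pf w)))) , proj₂ (pa (proj₂ (pf w)))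

_<$>_ : {A B : Set} → (A → B) → Parser A → Parser B
f <$> p = pure f <*> p

_>>=_ : {A B : Set} → Parser A → (A → Parser B) → Parser B
(p >>= f) w = f (proj₁ (p w)) (proj₂ (p w))

module _ {A B : Set} where

  <*>-parses : ∀ (pf : Parser (A → B)) (pa : Parser A) w {w′ r f a} →
               pf w ≡ (f , w′) → pa w′ ≡ (a , r) → (pf <*> pa) w ≡ (f a , r)
  <*>-parses pf pa w eq₁ eq₂ rewrite eq₁ | eq₂ = refl

  <$>-parses : ∀ (f : A → B) (p : Parser A) w {r a} → p w ≡ (a , r) → (f <$> p) w ≡ (f a , r)
  <$>-parses f p w = <*>-parses (pure f) p w refl

  >>=-parses : ∀ (p : Parser A) (f : A → Parser B) w {w′ a} → p w ≡ (a , w′) → (p >>= f) w ≡ f a w′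
  >>=-parses p f w eq rewrite eq = refl

natParser : Parser ℕ
natParser []           = 0 , []
natParser (false ∷ w) = 0 , w
natParser (true ∷ w)  = suc (proj₁ (natParser w)) , proj₂ (natParser w)

encodeNat : ℕ → Str → Str
encodeNat zero    r = false ∷ r
encodeNat (suc n) r = true ∷ encodeNat n r

natParser-parses : Parses natParser encodeNat
natParser-parses zero    r = refl
natParser-parses (suc n) r rewrite natParser-parses n r = refl

-- out-of-range numbers are clamped, so every string decodes to something
clamp : (s : ℕ) → ℕ → Fin (suc s)
clamp s       zero    = zero
clamp zero    (suc n) = zero
clamp (suc s) (suc n) = suc (clamp s n)

clamp-toℕ : ∀ s (q : Fin (suc s)) → clamp s (toℕ q) ≡ q
clamp-toℕ s       zero    = refl
clamp-toℕ (suc s) (suc q) = cong suc (clamp-toℕ s q)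

finParser : (s : ℕ) → Parser (Fin (suc s))
finParser s = clamp s <$> natParser

encodeFin : ∀ {s} → Fin (suc s) → Str → Str
encodeFin q = encodeNat (toℕ q)

finParser-parses : ∀ s → Parses (finParser s) encodeFin
finParser-parses s q r = trans (<$>-parses (clamp s) natParser _ (natParser-parses (toℕ q) r)) (cong (_, r) (clamp-toℕ s q))

vecParser : ∀ {A : Set} k → Parser A → Parser (Vec A k)
vecParser zero    p = pure []
vecParser (suc k) p = _∷_ <$> p <*> vecParser k p

encodeVec : ∀ {A : Set} {k} → (A → Str → Str) → Vec A k → Str → Str
encodeVec e []       r = r
encodeVec e (a ∷ as) r = e a (encodeVec e as r)

vecParser-parses : ∀ {A : Set} k (p : Parser A) e → Parses p e → Parses (vecParser k p) (encodeVec e)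
vecParser-parses zero    p e p-parses []       r = refl
vecParser-parses (suc k) p e p-parses (a ∷ as) r =
  <*>-parses (_∷_ <$> p) (vecParser k p) w (<$>-parses _∷_ p w (p-parses a _)) (vecParser-parses k p e p-parses as r)
  where
  w : Str
  w = e a (encodeVec e as r)

symParser : Parser Sym
symParser = fromIndex <$> natParser
  where
  fromIndex : ℕ → Sym
  fromIndex 0 = blank
  fromIndex 1 = s0
  fromIndex _ = s1

encodeSym : Sym → Str → Str
encodeSym blank = encodeNat 0
encodeSym s0    = encodeNat 1
encodeSym s1    = encodeNat 2

symParser-parses : Parses symParser encodeSym
symParser-parses blank r = refl
symParser-parses s0    r = refl
symParser-parses s1    r = refl

moveParser : Parser Move
moveParser = fromIndex <$> natParser
  where
  fromIndex : ℕ → Move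
  fromIndex 0 = L
  fromIndex 1 = R
  fromIndex _ = S

encodeMove : Move → Str → Str
encodeMove L = encodeNat 0
encodeMove R = encodeNat 1
encodeMove S = encodeNat 2

moveParser-parses : Parses moveParser encodeMove
moveParser-parses L r = refl
moveParser-parses R r = refl
moveParser-parses S r = refl

actionParser : (s : ℕ) → Parser (Action (suc s))
actionParser s = natParser >>= tagged
  where
  tagged : ℕ → Parser (Action (suc s))
  tagged 0 = pure halt
  tagged 1 = query <$> finParser s <*> finParser s
  tagged _ = step <$> finParser s <*> symParser <*> moveParser <*> symParser <*> moveParser

encodeAction : ∀ {s} → Action (suc s) → Str → Str
encodeAction halt                r = encodeNat 0 r
encodeAction (query q₁ q₂)       r = encodeNat 1 (encodeFin q₁ (encodeFin q₂ r))
encodeAction (step q a m b m′)   r = encodeNat 2 (encodeFin q (encodeSym a (encodeMove m (encodeSym b (encodeMove m′ r)))))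

actionParser-parses : ∀ s → Parses (actionParser s) encodeAction
actionParser-parses s halt            r = refl
actionParser-parses s (query q₁ q₂)   r =
  <*>-parses (query <$> finParser s) (finParser s) w (<$>-parses query (finParser s) w (finParser-parses s q₁ (encodeFin q₂ r)))
    (finParser-parses s q₂ r)
  where
  w : Str
  w = encodeFin q₁ (encodeFin q₂ r)
actionParser-parses s (step q a m b m′) r =
  <*>-parses p₄ moveParser w (<*>-parses p₃ symParser w (<*>-parses p₂ moveParser w (<*>-parses p₁ symParser w
    (<$>-parses step (finParser s) w (finParser-parses s q (encodeSym a (encodeMove m (encodeSym b (encodeMove m′ r))))))
    (symParser-parses a (encodeMove m (encodeSym b (encodeMove m′ r)))))
    (moveParser-parses m (encodeSym b (encodeMove m′ r))))
    (symParser-parses b (encodeMove m′ r)))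
    (moveParser-parses m′ r)
  where
  w : Str
  w = encodeFin q (encodeSym a (encodeMove m (encodeSym b (encodeMove m′ r))))
  p₁ : Parser (Sym → Move → Sym → Move → Action (suc s))
  p₁ = step <$> finParser s
  p₂ : Parser (Move → Sym → Move → Action (suc s))
  p₂ = p₁ <*> symParser
  p₃ : Parser (Sym → Move → Action (suc s))
  p₃ = p₂ <*> moveParser
  p₄ : Parser (Move → Action (suc s))
  p₄ = p₃ <*> symParser

record Code : Set where
  constructor mkCode
  field
    size  : ℕ
    start : Fin (suc size)
    table : Vec (Vec (Vec (Action (suc size)) 3) 3) (suc size)

symIndex : Sym → Fin 3
symIndex blank = zero
symIndex s0    = suc zero
symIndex s1    = suc (suc zero)

symAt : Fin 3 → Sym
symAt zero          = blank
symAt (suc zero)    = s0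
symAt (suc (suc _)) = s1

symAt-symIndex : ∀ a → symAt (symIndex a) ≡ a
symAt-symIndex blank = refl
symAt-symIndex s0    = refl
symAt-symIndex s1    = refl

toOTM : Code → OTM
toOTM (mkCode n st tbl) = record
  { states = suc n ; start = st ; δ = λ q a b → lookup (lookup (lookup tbl q) (symIndex a)) (symIndex b) }

tableParser : (n : ℕ) → Parser (Vec (Vec (Vec (Action (suc n)) 3) 3) (suc n))
tableParser n = vecParser (suc n) (vecParser 3 (vecParser 3 (actionParser n)))

encodeTable : ∀ {n} → Vec (Vec (Vec (Action (suc n)) 3) 3) (suc n) → Str → Str
encodeTable = encodeVec (encodeVec (encodeVec encodeAction))

tableParser-parses : ∀ n → Parses (tableParser n) encodeTable
tableParser-parses n =
  vecParser-parses (suc n) (vecParser 3 (vecParser 3 (actionParser n))) (encodeVec (encodeVec encodeAction))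
    (vecParser-parses 3 (vecParser 3 (actionParser n)) (encodeVec encodeAction)
      (vecParser-parses 3 (actionParser n) encodeAction (actionParser-parses n)))

codeParser : Parser Code
codeParser = natParser >>= λ n → mkCode n <$> finParser n <*> tableParser n

encodeCode : Code → Str → Str
encodeCode (mkCode n st tbl) r = encodeNat n (encodeFin st (encodeTable tbl r))

codeParser-parses : Parses codeParser encodeCode
codeParser-parses (mkCode n st tbl) r =
  trans (>>=-parses natParser (λ n → mkCode n <$> finParser n <*> tableParser n) (encodeNat n w) (natParser-parses n w))
        (<*>-parses (mkCode n <$> finParser n) (tableParser n) w
                    (<$>-parses (mkCode n) (finParser n) w (finParser-parses n st (encodeTable tbl r)))
                    (tableParser-parses n tbl r))
  where
  w : Str
  w = encodeFin st (encodeTable tbl r)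

indexedParser : Parser (OTM × ℕ)
indexedParser = natParser >>= λ k → (λ c → toOTM c , k) <$> codeParser

-- Every number names a machine with a time exponent: i > 0 is read from the bits of bin i after its leading 1.
-- Matching on bin i keeps machineAt i stuck for a variable i; unfolding the parsers there blows up type checking.
machineNamed : Str → OTM × ℕ
machineNamed []       = proj₁ (indexedParser [])
machineNamed (_ ∷ w) = proj₁ (indexedParser w)

machineAt : ℕ → OTM × ℕ
machineAt i = machineNamed (bin i)

Mᵢ : ℕ → OTM
Mᵢ i = proj₁ (machineAt i)

kᵢ : ℕ → ℕ
kᵢ i = proj₂ (machineAt i)

machineAt-index : ∀ c k → machineAt (valFrom 1 (encodeNat k (encodeCode c []))) ≡ (toOTM c , k)
machineAt-index c k = begin
    machineAt (valFrom 1 w) ≡⟨ cong machineNamed (bin-valFrom-1 w) ⟩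
    proj₁ (indexedParser w) ≡⟨ cong proj₁ parsed ⟩
    (toOTM c , k)                                     ∎
  where
  open ≡-Reasoning
  w : Str
  w = encodeNat k (encodeCode c [])
  parsed : indexedParser w ≡ ((toOTM c , k) , [])
  parsed = trans (>>=-parses natParser (λ k → (λ c → toOTM c , k) <$> codeParser) w (natParser-parses k (encodeCode c [])))
                 (<$>-parses (λ c → toOTM c , k) codeParser (encodeCode c []) (codeParser-parses c []))

-- Factoring stepConfig and isHalted through the prescribed action lets them be compared across machines
-- whose tables agree pointwise but are not definitionally equal.
perform : (X : Lang) (M : OTM) → Action (OTM.states M) → Config M → Maybe (Config M)
perform X M halt               c            = nothing
perform X M (query qy qn)      (cfg q w t)  = just (cfg (if X (readTape t) then qy else qn) w emptyTape)
perform X M (step q′ a m b m′) (cfg q w t)  = just (cfg q′ (moveT m (writeT a w)) (moveT m′ (writeT b t)))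

stepConfig-perform : ∀ X M q w t → stepConfig X M (cfg q w t) ≡ perform X M (OTM.δ M q (here w) (here t)) (cfg q w t)
stepConfig-perform X M q w t with OTM.δ M q (here w) (here t)
... | halt           = refl
... | query _ _      = refl
... | step _ _ _ _ _ = refl

isHaltAction : ∀ {n} → Action n → Bool
isHaltAction halt             = true
isHaltAction (query _ _)      = false
isHaltAction (step _ _ _ _ _) = false

isHalted-isHaltAction : ∀ M q w t → isHalted M (cfg q w t) ≡ isHaltAction (OTM.δ M q (here w) (here t))
isHalted-isHaltAction M q w t with OTM.δ M q (here w) (here t)
... | halt           = refl
... | query _ _      = refl
... | step _ _ _ _ _ = refl

continue : (X : Lang) (M : OTM) → ℕ → Config M → Maybe (Config M) → Config M
continue X M t c nothing   = c
continue X M t c (just c′) = runFor X M t c′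

runFor-suc : ∀ X M t c → runFor X M (suc t) c ≡ continue X M t c (stepConfig X M c)
runFor-suc X M t c with stepConfig X M c
... | nothing = refl
... | just _  = refl

module _ {n : ℕ} {st : Fin n} {δ₁ δ₂ : Fin n → Sym → Sym → Action n} (δ₁≗δ₂ : ∀ q a b → δ₁ q a b ≡ δ₂ q a b) where

  private
    M₁ : OTM
    M₁ = record { states = n ; start = st ; δ = δ₁ }

    M₂ : OTM
    M₂ = record { states = n ; start = st ; δ = δ₂ }

    convert : Config M₁ → Config M₂
    convert (cfg q w t) = cfg q w t

    convertMaybe : Maybe (Config M₁) → Maybe (Config M₂)
    convertMaybe nothing  = nothing
    convertMaybe (just c) = just (convert c)

    perform-convert : ∀ X a c → perform X M₂ a (convert c) ≡ convertMaybe (perform X M₁ a c)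
    perform-convert X halt             c           = refl
    perform-convert X (query _ _)      (cfg q w t) = refl
    perform-convert X (step _ _ _ _ _) (cfg q w t) = refl

    stepConfig-convert : ∀ X c → stepConfig X M₂ (convert c) ≡ convertMaybe (stepConfig X M₁ c)
    stepConfig-convert X (cfg q w t) = begin
        stepConfig X M₂ (cfg q w t)                           ≡⟨ stepConfig-perform X M₂ q w t ⟩
        perform X M₂ (δ₂ q (here w) (here t)) (cfg q w t)     ≡⟨ cong (λ a → perform X M₂ a (cfg q w t)) (δ₁≗δ₂ q (here w) (here t)) ⟨
        perform X M₂ (δ₁ q (here w) (here t)) (cfg q w t)     ≡⟨ perform-convert X (δ₁ q (here w) (here t)) (cfg q w t) ⟩
        convertMaybe (perform X M₁ (δ₁ q (here w) (here t)) (cfg q w t)) ≡⟨ cong convertMaybe (stepConfig-perform X M₁ q w t) ⟨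
        convertMaybe (stepConfig X M₁ (cfg q w t))           ∎
      where open ≡-Reasoning

    runFor-convert : ∀ X t c → runFor X M₂ t (convert c) ≡ convert (runFor X M₁ t c)
    runFor-convert X zero    c = refl
    runFor-convert X (suc t) c = begin
        runFor X M₂ (suc t) (convert c)                          ≡⟨ runFor-suc X M₂ t (convert c) ⟩
        continue X M₂ t (convert c) (stepConfig X M₂ (convert c)) ≡⟨ cong (continue X M₂ t (convert c)) (stepConfig-convert X c) ⟩
        continue X M₂ t (convert c) (convertMaybe (stepConfig X M₁ c)) ≡⟨ continue-convert (stepConfig X M₁ c) ⟩
        convert (continue X M₁ t c (stepConfig X M₁ c))          ≡⟨ cong convert (runFor-suc X M₁ t c) ⟨
        convert (runFor X M₁ (suc t) c)                          ∎
      where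
      open ≡-Reasoning
      continue-convert : ∀ m → continue X M₂ t (convert c) (convertMaybe m) ≡ convert (continue X M₁ t c m)
      continue-convert nothing   = refl
      continue-convert (just c′) = runFor-convert X t c′

    isHalted-convert : ∀ c → isHalted M₂ (convert c) ≡ isHalted M₁ c
    isHalted-convert (cfg q w t) = trans (isHalted-isHaltAction M₂ q w t)
      (trans (cong isHaltAction (sym (δ₁≗δ₂ q (here w) (here t)))) (sym (isHalted-isHaltAction M₁ q w t)))

  computesIn-δ-cong : ∀ {X f k} → ComputesIn X M₁ f k → ComputesIn X M₂ f k
  computesIn-δ-cong {X} {f} {k} comp x with comp x
  ... | halts , outputs =
    trans (cong (isHalted M₂) runs) (trans (isHalted-convert (runFor X M₁ (length x ^ k + k) (initConfig M₁ x))) halts) ,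
    trans (cong (output M₂) runs) outputs
    where
    runs : runFor X M₂ (length x ^ k + k) (initConfig M₂ x) ≡ convert (runFor X M₁ (length x ^ k + k) (initConfig M₁ x))
    runs = runFor-convert X (length x ^ k + k) (initConfig M₁ x)

code-simulates : ∀ M → Σ Code λ c → ∀ {X f k} → ComputesIn X M f k → ComputesIn X (toOTM c) f k
code-simulates record { states = zero  ; start = () }
code-simulates record { states = suc n ; start = st ; δ = δ } =
  mkCode n st table , λ {X} {f} {k} → computesIn-δ-cong table-correct {X} {f} {k}
  where
  table : Vec (Vec (Vec (Action (suc n)) 3) 3) (suc n)
  table = tabulate λ q → tabulate λ i → tabulate λ j → δ q (symAt i) (symAt j)
  table-correct : ∀ q a b → δ q a b ≡ lookup (lookup (lookup table q) (symIndex a)) (symIndex b)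
  table-correct q a b rewrite lookup∘tabulate (λ q → tabulate λ i → tabulate λ j → δ q (symAt i) (symAt j)) q
                            | lookup∘tabulate (λ i → tabulate λ j → δ q (symAt i) (symAt j)) (symIndex a)
                            | lookup∘tabulate (λ j → δ q (symAt (symIndex a)) (symAt j)) (symIndex b)
                            | symAt-symIndex a | symAt-symIndex b = refl

machineAt-complete : ∀ M k → Σ ℕ λ i → ∀ {X f} → ComputesIn X M f k → ComputesIn X (Mᵢ i) f (kᵢ i)
machineAt-complete M k with code-simulates M
... | c , simulates = valFrom 1 (encodeNat k (encodeCode c [])) , λ {X} {f} comp →
  subst (λ (M′ , k′) → ComputesIn X M′ f k′) (sym (machineAt-index c k)) (simulates {X} {f} {k} comp)

2^-double : ∀ n → 2 ^ suc n ≡ 2 ^ n + 2 ^ n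
2^-double n = cong (2 ^ n +_) (+-identityʳ (2 ^ n))

1≤2^ : ∀ n → 1 ≤ 2 ^ n
1≤2^ n = m^n>0 2 n

n<2^n : ∀ n → n < 2 ^ n
n<2^n zero    = s≤s z≤n
n<2^n (suc n) = subst (suc n <_) (sym (2^-double n)) (subst (_≤ 2 ^ n + 2 ^ n) (+-comm (suc n) 1) (+-mono-≤ (n<2^n n) (1≤2^ n)))

square≤2^ : ∀ d → (d + 4) * (d + 4) ≤ 2 ^ (d + 4)
square≤2^ zero    = ≤-refl
square≤2^ (suc d) = begin
    (suc d + 4) * (suc d + 4)             ≡⟨ expand d ⟩
    (d + 4) * (d + 4) + (2 * d + 9)       ≤⟨ +-monoʳ-≤ ((d + 4) * (d + 4)) (subst (2 * d + 9 ≤_) (sym (split d)) (m≤m+n _ _)) ⟩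
    (d + 4) * (d + 4) + (d + 4) * (d + 4) ≤⟨ +-mono-≤ (square≤2^ d) (square≤2^ d) ⟩
    2 ^ (d + 4) + 2 ^ (d + 4)             ≡⟨ 2^-double (d + 4) ⟨
    2 ^ (suc d + 4)                       ∎
  where
  open ≤-Reasoning
  expand : ∀ d → (suc d + 4) * (suc d + 4) ≡ (d + 4) * (d + 4) + (2 * d + 9)
  expand = solve-∀
  split : ∀ d → (d + 4) * (d + 4) ≡ (2 * d + 9) + (d * d + 6 * d + 7)
  split = solve-∀

2^+k<2^ : ∀ a k → 2 ^ a + k < 2 ^ (a + suc k)
2^+k<2^ a k = begin-strict
    2 ^ a + k               <⟨ +-monoʳ-< (2 ^ a) (≤-refl {suc k}) ⟩
    2 ^ a + suc k           ≤⟨ +-monoʳ-≤ (2 ^ a) (subst (suc k ≤_) (*-comm (suc k) (2 ^ a)) (m≤m*n (suc k) (2 ^ a) {{>-nonZero (1≤2^ a)}})) ⟩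
    2 ^ a + 2 ^ a * suc k   ≡⟨ *-suc (2 ^ a) (suc k) ⟨
    2 ^ a * suc (suc k)     ≤⟨ *-monoʳ-≤ (2 ^ a) (n<2^n (suc k)) ⟩
    2 ^ a * 2 ^ suc k       ≡⟨ ^-distribˡ-+-* 2 a (suc k) ⟨
    2 ^ (a + suc k)         ∎
  where open ≤-Reasoning

-- A length m ≥ ℓ at which a machine running in time n^k + k on inputs 1^(m+1) asks fewer than 2^m queries.
lengthAbove : ℕ → ℕ → ℕ
lengthAbove k ℓ = 2 ^ (ℓ + k + 4)

lengthAbove-≥ : ∀ k ℓ → ℓ ≤ lengthAbove k ℓ
lengthAbove-≥ k ℓ = ≤-trans (≤-trans (m≤m+n ℓ k) (m≤m+n (ℓ + k) 4)) (<⇒≤ (n<2^n (ℓ + k + 4)))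

lengthAbove-fits : ∀ k ℓ → suc (lengthAbove k ℓ) ^ k + k < 2 ^ lengthAbove k ℓ
lengthAbove-fits k ℓ = begin-strict
    suc m ^ k + k         ≤⟨ +-monoˡ-≤ k (^-monoˡ-≤ k (+-monoˡ-≤ m (1≤2^ j))) ⟩
    (m + m) ^ k + k       ≡⟨ cong (λ v → v ^ k + k) (2^-double j) ⟨
    (2 ^ suc j) ^ k + k   ≡⟨ cong (_+ k) (^-*-assoc 2 (suc j) k) ⟩
    2 ^ (suc j * k) + k   <⟨ 2^+k<2^ (suc j * k) k ⟩
    2 ^ (suc j * k + suc k) ≤⟨ ^-monoʳ-≤ 2 exponent≤ ⟩
    2 ^ m                 ∎
  where
  open ≤-Reasoning
  j : ℕ
  j = ℓ + k + 4
  m : ℕ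
  m = 2 ^ j
  split : ∀ ℓ k → (ℓ + k + 4) * (ℓ + k + 4) ≡ (suc (ℓ + k + 4) * k + suc k) + (ℓ * ℓ + ℓ * k + 8 * ℓ + 2 * k + 15)
  split = solve-∀
  exponent≤ : suc j * k + suc k ≤ m
  exponent≤ = ≤-trans (subst (suc j * k + suc k ≤_) (sym (split ℓ k)) (m≤m+n _ _)) (square≤2^ (ℓ + k))

tails : Bool → List Str → List Str
tails b     []                = []
tails b     ([] ∷ Q)          = tails b Q
tails false ((false ∷ x) ∷ Q) = x ∷ tails false Q
tails false ((true ∷ x) ∷ Q)  = tails false Q
tails true  ((true ∷ x) ∷ Q)  = x ∷ tails true Q
tails true  ((false ∷ x) ∷ Q) = tails true Q

length-tails : ∀ Q → length (tails false Q) + length (tails true Q) ≤ length Q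
length-tails []                = z≤n
length-tails ([] ∷ Q)          = m≤n⇒m≤1+n (length-tails Q)
length-tails ((false ∷ x) ∷ Q) = s≤s (length-tails Q)
length-tails ((true ∷ x) ∷ Q)  = subst (_≤ suc (length Q)) (sym (+-suc _ _)) (s≤s (length-tails Q))

∈-tails : ∀ b x Q → b ∷ x ∈ Q → x ∈ tails b Q
∈-tails false x ((false ∷ _) ∷ Q) (Any.here refl) = Any.here refl
∈-tails true  x ((true ∷ _) ∷ Q)  (Any.here refl) = Any.here refl
∈-tails b     x ([] ∷ Q)          (there p)   = ∈-tails b x Q p
∈-tails false x ((false ∷ _) ∷ Q) (there p)   = there (∈-tails false x Q p)
∈-tails false x ((true ∷ _) ∷ Q)  (there p)   = ∈-tails false x Q p
∈-tails true  x ((true ∷ _) ∷ Q)  (there p)   = there (∈-tails true x Q p)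
∈-tails true  x ((false ∷ _) ∷ Q) (there p)   = ∈-tails true x Q p

rarerBit : List Str → Bool
rarerBit Q = does (length (tails true Q) <? length (tails false Q))

double-tails-rarerBit : ∀ Q → 2 * length (tails (rarerBit Q) Q) ≤ length Q
double-tails-rarerBit Q = by-comparison (length (tails true Q) <? length (tails false Q))
  where
  #t : ℕ
  #t = length (tails true Q)
  #f : ℕ
  #f = length (tails false Q)
  by-comparison : (d : Dec (#t < #f)) → 2 * length (tails (does d) Q) ≤ length Q
  by-comparison (yes t<f) = begin
      #t + (#t + 0) ≡⟨ cong (#t +_) (+-identityʳ #t) ⟩
      #t + #t       ≤⟨ +-monoʳ-≤ #t (<⇒≤ t<f) ⟩
      #t + #f       ≡⟨ +-comm #t #f ⟩
      #f + #t       ≤⟨ length-tails Q ⟩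
      length Q      ∎
    where open ≤-Reasoning
  by-comparison (no t≮f) = begin
      #f + (#f + 0) ≡⟨ cong (#f +_) (+-identityʳ #f) ⟩
      #f + #f       ≤⟨ +-monoʳ-≤ #f (≮⇒≥ t≮f) ⟩
      #f + #t       ≤⟨ length-tails Q ⟩
      length Q      ∎
    where open ≤-Reasoning

-- Following the rarer first bit at every step at least halves the list of strings still to avoid.
fresh : ℕ → List Str → Str
fresh zero    Q = []
fresh (suc m) Q = rarerBit Q ∷ fresh m (tails (rarerBit Q) Q)

length-fresh : ∀ m Q → length (fresh m Q) ≡ m
length-fresh zero    Q = refl
length-fresh (suc m) Q = cong suc (length-fresh m (tails (rarerBit Q) Q))

fresh-∉ : ∀ m Q → length Q < 2 ^ m → fresh m Q ∉ Q
fresh-∉ zero    []      _         ()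
fresh-∉ zero    (_ ∷ Q) (s≤s ())
fresh-∉ (suc m) Q       |Q|<2^1+m b∷y∈Q =
  fresh-∉ m (tails (rarerBit Q) Q) (*-cancelˡ-< 2 _ _ (≤-<-trans (double-tails-rarerBit Q) |Q|<2^1+m)) (∈-tails (rarerBit Q) _ Q b∷y∈Q)

from-does : ∀ {P : Set} (d : Dec P) → does d ≡ true → P
from-does (yes p) _ = p

ones : ℕ → Str
ones m = replicate (suc m) true

timeOn : ℕ → ℕ → ℕ
timeOn m k = length (ones m) ^ k + k

-- Stage i works at length stageLength i, beyond everything the earlier stages could read.
stageLength : ℕ → ℕ
stageLength zero    = lengthAbove (kᵢ 0) 0
stageLength (suc i) = lengthAbove (kᵢ (suc i)) (suc (stageLength i + timeOn (stageLength i) (kᵢ i)))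

budget : ℕ → ℕ
budget i = timeOn (stageLength i) (kᵢ i)

module Stage (i : ℕ) (P : List Str) where

  oracle : Lang
  oracle = Swapped (λ y → does (y ∈? P))

  input : Str
  input = ones (stageLength i)

  run : Config (Mᵢ i)
  run = runFor oracle (Mᵢ i) (budget i) (initConfig (Mᵢ i) input)

  asked : List Str
  asked = queries oracle (Mᵢ i) (budget i) (initConfig (Mᵢ i) input)

  -- Mᵢ answers 2^m on 1^(m+1), which the stage then falsifies by adding a fresh y of length m to D.
  claims2^m : Bool
  claims2^m = isHalted (Mᵢ i) run ∧ does (output (Mᵢ i) run ≟ₛ bin (2 ^ stageLength i))

  witness : Str
  witness = fresh (stageLength i) (map candidate asked)

  added : List Str
  added = if claims2^m then witness ∷ [] else []

before : ℕ → List Str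
before zero    = []
before (suc i) = before i ++ Stage.added i (before i)

added : ℕ → List Str
added i = Stage.added i (before i)

D : Str → Bool
D y = does (y ∈? before (suc (length y)))

A : Lang
A = Swapped D

B : Lang
B x = startsWith1 (swap A x)

budget-pos : ∀ i → 1 ≤ budget i
budget-pos i = ≤-trans (m^n>0 (length (ones (stageLength i))) (kᵢ i)) (m≤m+n _ (kᵢ i))

stageLength-step : ∀ i → suc (stageLength i + budget i) ≤ stageLength (suc i)
stageLength-step i = lengthAbove-≥ (kᵢ (suc i)) _

stageLength-far : ∀ {i j} → i < j → suc (stageLength i + budget i) ≤ stageLength j
stageLength-far {i} {suc j} i<1+j with m<1+n⇒m<n∨m≡n i<1+j
... | inj₂ refl = stageLength-step i
... | inj₁ i<j  = ≤-trans (stageLength-far i<j) (≤-trans (m≤n⇒m≤1+n (m≤m+n _ _)) (stageLength-step j))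

stageLength-injective : ∀ {i j} → stageLength i ≡ stageLength j → i ≡ j
stageLength-injective {i} {j} eq with <-cmp i j
... | tri≈ _ i≡j _ = i≡j
... | tri< i<j _ _ = ⊥-elim (<-irrefl eq (≤-trans (s≤s (m≤m+n _ _)) (stageLength-far i<j)))
... | tri> _ _ j<i = ⊥-elim (<-irrefl (sym eq) (≤-trans (s≤s (m≤m+n _ _)) (stageLength-far j<i)))

i≤stageLength : ∀ i → i ≤ stageLength i
i≤stageLength zero    = z≤n
i≤stageLength (suc i) = ≤-trans (s≤s (≤-trans (i≤stageLength i) (m≤m+n _ _))) (stageLength-step i)

budget<2^ : ∀ i → budget i < 2 ^ stageLength i
budget<2^ i = subst (λ n → n ^ kᵢ i + kᵢ i < 2 ^ stageLength i) (sym (length-replicate (suc (stageLength i)))) (fits i)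
  where
  fits : ∀ i → suc (stageLength i) ^ kᵢ i + kᵢ i < 2 ^ stageLength i
  fits zero    = lengthAbove-fits (kᵢ 0) 0
  fits (suc i) = lengthAbove-fits (kᵢ (suc i)) (suc (stageLength i + budget i))

module _ (i : ℕ) where
  open Stage i (before i) hiding (added)

  Outcome : Set
  Outcome = (claims2^m ≡ true × added i ≡ witness ∷ []) ⊎ (claims2^m ≡ false × added i ≡ [])

  outcome : Outcome
  outcome = by-claim claims2^m refl
    where
    by-claim : ∀ b → claims2^m ≡ b → Outcome
    by-claim true  c = inj₁ (c , cong (λ b → if b then witness ∷ [] else []) c)
    by-claim false c = inj₂ (c , cong (λ b → if b then witness ∷ [] else []) c)

  ∈-added⇒witness : ∀ {y} → y ∈ added i → y ≡ witness
  ∈-added⇒witness {y} y∈ = from-cases outcome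
    where
    from-cases : Outcome → y ≡ witness
    from-cases (inj₁ (_ , eq)) with subst (y ∈_) eq y∈
    ... | Any.here y≡w = y≡w
    from-cases (inj₂ (_ , eq)) with subst (y ∈_) eq y∈
    ... | ()

  length-added : ∀ {y} → y ∈ added i → length y ≡ stageLength i
  length-added y∈ = trans (cong length (∈-added⇒witness y∈)) (length-fresh (stageLength i) (map candidate asked))

  candidate-∉-added : ∀ {q} → q ∈ asked → candidate q ∉ added i
  candidate-∉-added {q} q∈ cq∈ =
    fresh-∉ (stageLength i) (map candidate asked) few (subst (_∈ map candidate asked) (∈-added⇒witness cq∈) (∈-map⁺ candidate q∈))
    where
    few : length (map candidate asked) < 2 ^ stageLength i
    few = ≤-<-trans (≤-reflexive (length-map candidate asked))
                    (≤-<-trans (length-queries oracle (Mᵢ i) (budget i) _) (budget<2^ i))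

∈-before⁻ : ∀ n {y} → y ∈ before n → Σ ℕ λ i → i < n × y ∈ added i
∈-before⁻ (suc n) y∈ with ∈-++⁻ (before n) y∈
... | inj₁ y∈before = let i , i<n , y∈added = ∈-before⁻ n y∈before in i , m<n⇒m<1+n i<n , y∈added
... | inj₂ y∈added  = n , ≤-refl , y∈added

∈-before⁺ : ∀ {i n y} → i < n → y ∈ added i → y ∈ before n
∈-before⁺ {i} {suc n} i<1+n y∈ with m<1+n⇒m<n∨m≡n i<1+n
... | inj₁ i<n  = ∈-++⁺ˡ (∈-before⁺ i<n y∈)
... | inj₂ refl = ∈-++⁺ʳ (before i) y∈

-- Stage i only adds strings of length stageLength i ≥ i, so the stages before |y| + 1 are all that matter.
∈-before-own-length : ∀ {y} → y ∈ before (suc (length y)) ⇔ Σ ℕ λ i → y ∈ added i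
∈-before-own-length {y} = mk⇔
  (λ y∈ → let i , _ , y∈added = ∈-before⁻ (suc (length y)) y∈ in i , y∈added)
  (λ (i , y∈added) → ∈-before⁺ (s≤s (subst (i ≤_) (sym (length-added i y∈added)) (i≤stageLength i))) y∈added)

D-agrees-before : ∀ j {y} → length y ≤ budget j → y ∉ added j → D y ≡ does (y ∈? before j)
D-agrees-before j {y} y≤budget y∉ = does-⇔ (mk⇔ to from) (y ∈? before (suc (length y))) (y ∈? before j)
  where
  to : y ∈ before (suc (length y)) → y ∈ before j
  to y∈ with Equivalence.to ∈-before-own-length y∈
  ... | i , y∈added with <-cmp i j
  ...   | tri< i<j _ _ = ∈-before⁺ i<j y∈added
  ...   | tri≈ _ refl _ = ⊥-elim (y∉ y∈added)
  ...   | tri> _ _ j<i = ⊥-elim (<-irrefl (length-added i y∈added)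
                           (≤-trans (s≤s (≤-trans y≤budget (m≤n+m (budget j) (stageLength j)))) (stageLength-far j<i)))
  from : y ∈ before j → y ∈ before (suc (length y))
  from y∈ = let i , _ , y∈added = ∈-before⁻ j y∈ in Equivalence.from ∈-before-own-length (i , y∈added)

D-at-stage : ∀ j {y} → length y ≡ stageLength j → D y ≡ does (y ∈? added j)
D-at-stage j {y} |y|≡ =
  does-⇔ (mk⇔ to (λ y∈ → Equivalence.from ∈-before-own-length (j , y∈))) (y ∈? before (suc (length y))) (y ∈? added j)
  where
  to : y ∈ before (suc (length y)) → y ∈ added j
  to y∈ with Equivalence.to ∈-before-own-length y∈
  ... | i , y∈added with stageLength-injective {i} {j} (trans (sym (length-added i y∈added)) |y|≡)
  ...   | refl = y∈added

D-below-stage : ∀ j {y} → suc (length y) ≡ stageLength j → D y ≡ false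
D-below-stage j {y} 1+|y|≡ = dec-false (y ∈? before (suc (length y))) absent
  where
  absent : y ∉ before (suc (length y))
  absent y∈ with Equivalence.to ∈-before-own-length y∈
  ... | i , y∈added with length-added i y∈added | <-cmp i j
  ...   | |y|≡ | tri< i<j _ _ = <-irrefl refl (<-≤-trans (m<m+n (stageLength i) (budget-pos i))
                                 (≤-pred (≤-trans (stageLength-far i<j) (≤-reflexive (trans (sym 1+|y|≡) (cong suc |y|≡))))))
  ...   | |y|≡ | tri≈ _ refl _ = 1+n≢n (trans 1+|y|≡ (sym |y|≡))
  ...   | |y|≡ | tri> _ _ j<i = <-irrefl refl (≤-trans (≤-reflexive (trans (cong suc (sym |y|≡)) 1+|y|≡))
                                 (≤-trans (m≤m+n _ _) (≤-trans (n≤1+n _) (stageLength-far j<i))))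

stage-agrees : ∀ j → Stage.run j (before j) ≡ runFor A (Mᵢ j) (budget j) (initConfig (Mᵢ j) (ones (stageLength j)))
stage-agrees j = runFor-oracle-cong oracle A (Mᵢ j) (budget j) (initConfig (Mᵢ j) input) (All.tabulate agrees)
  where
  open Stage j (before j) hiding (added)
  agrees : ∀ {q} → q ∈ asked → oracle q ≡ A q
  agrees {q} q∈ = Swapped-cong _ D q (sym (D-agrees-before j
    (length-candidate q (budget j) (All.lookup (queries-from-start oracle (Mᵢ j) (budget j) input) q∈))
    (candidate-∉-added j q∈)))

startsWith1-swapWith-1 : ∀ a y → startsWith1 (swapWith a true y) ≡ not a
startsWith1-swapWith-1 false y = refl
startsWith1-swapWith-1 true  y = refl

startsWith1-swapWith-0 : ∀ a z → startsWith1 (swapWith a false z) ≡ a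
startsWith1-swapWith-0 false z = refl
startsWith1-swapWith-0 true  z = refl

A-0∷-at-stage : ∀ j z → length z ≡ stageLength j → A (false ∷ z) ≡ false
A-0∷-at-stage j z |z|≡ = by-last (lastIs0 z) refl
  where
  by-last : ∀ b → lastIs0 z ≡ b → lastIs0 z ∧ D (dropLast z) ≡ false
  by-last false l = cong (_∧ D (dropLast z)) l
  by-last true  l = cong₂ _∧_ l (D-below-stage j {dropLast z} (trans (length-dropLast z l) |z|≡))

census-added : ∀ j → census (λ y → does (y ∈? added j)) (stageLength j) ≡ length (added j)
census-added j with outcome j
... | inj₁ (_ , eq) = begin
    census (λ y → does (y ∈? added j)) (stageLength j)
      ≡⟨ census-cong _ _ (stageLength j) (λ y _ → does-⇔ (∈-added⇔ y) (y ∈? added j) (y ≟ₛ w)) ⟩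
    census (λ y → does (y ≟ₛ w)) (stageLength j)
      ≡⟨ cong (census (λ y → does (y ≟ₛ w))) (length-added j (subst (w ∈_) (sym eq) (Any.here refl))) ⟨
    census (λ y → does (y ≟ₛ w)) (length w)
      ≡⟨ census-≡ w ⟩
    1
      ≡⟨ cong length eq ⟨
    length (added j) ∎
  where
  open ≡-Reasoning
  w : Str
  w = Stage.witness j (before j)
  ∈-added⇔ : ∀ y → y ∈ added j ⇔ y ≡ w
  ∈-added⇔ y = mk⇔ (∈-added⇒witness j) (λ y≡w → subst (y ∈_) (sym eq) (Any.here y≡w))
... | inj₂ (_ , eq) = begin
    census (λ y → does (y ∈? added j)) (stageLength j)
      ≡⟨ census-cong _ _ (stageLength j) (λ y _ → dec-false (y ∈? added j) (λ y∈ → ∉-[] (subst (y ∈_) eq y∈))) ⟩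
    census (λ _ → false) (stageLength j)
      ≡⟨ census-none (stageLength j) ⟩
    0
      ≡⟨ cong length eq ⟨
    length (added j) ∎
  where
  open ≡-Reasoning
  ∉-[] : ∀ {y} → y ∉ []
  ∉-[] ()

census-B-stage : ∀ j → census B (suc (stageLength j)) + length (added j) ≡ 2 ^ stageLength j
census-B-stage j = begin
    census B (suc m) + length (added j)
      ≡⟨ cong (_+ length (added j)) (census-suc B m) ⟩
    (census (λ z → B (false ∷ z)) m + census (λ y → B (true ∷ y)) m) + length (added j)
      ≡⟨ cong₂ (λ a b → (a + b) + length (added j)) (trans (census-cong _ _ m B-0∷) (census-none m)) (census-cong _ _ m B-1∷) ⟩
    census (λ y → not (inAdded y)) m + length (added j)
      ≡⟨ cong (census (λ y → not (inAdded y)) m +_) (census-added j) ⟨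
    census (λ y → not (inAdded y)) m + census inAdded m
      ≡⟨ +-comm (census (λ y → not (inAdded y)) m) (census inAdded m) ⟩
    census inAdded m + census (λ y → not (inAdded y)) m
      ≡⟨ census-complement inAdded m ⟩
    2 ^ m ∎
  where
  open ≡-Reasoning
  m : ℕ
  m = stageLength j
  inAdded : Str → Bool
  inAdded y = does (y ∈? added j)
  B-0∷ : ∀ z → length z ≡ m → B (false ∷ z) ≡ false
  B-0∷ z |z|≡ = trans (startsWith1-swapWith-0 (A (false ∷ z)) z) (A-0∷-at-stage j z |z|≡)
  B-1∷ : ∀ y → length y ≡ m → B (true ∷ y) ≡ not (inAdded y)
  B-1∷ y |y|≡ = trans (startsWith1-swapWith-1 (D y) y) (cong not (D-at-stage j |y|≡))

stage-defeats : ∀ i {f} → ComputesIn A (Mᵢ i) f (kᵢ i) → f (ones (stageLength i)) ≢ bin (census B (suc (stageLength i)))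
stage-defeats i {f} comp f≡census = by-claim (outcome i)
  where
  open Stage i (before i) hiding (added)
  m : ℕ
  m = stageLength i
  run-halts : isHalted (Mᵢ i) run ≡ true
  run-halts = trans (cong (isHalted (Mᵢ i)) (stage-agrees i)) (proj₁ (comp input))
  claims≡ : claims2^m ≡ does (output (Mᵢ i) run ≟ₛ bin (2 ^ m))
  claims≡ = cong (_∧ does (output (Mᵢ i) run ≟ₛ bin (2 ^ m))) run-halts
  answers-census : output (Mᵢ i) run ≡ bin (census B (suc m))
  answers-census = trans (cong (output (Mᵢ i)) (stage-agrees i)) (trans (proj₂ (comp input)) f≡census)
  by-claim : Outcome i → ⊥
  by-claim (inj₁ (claimed , eq)) = bin-ones≢bin-2^ m (begin
      bin (val (replicate m true)) ≡⟨ cong bin census≡ ⟨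
      bin (census B (suc m))       ≡⟨ answers-census ⟨
      output (Mᵢ i) run            ≡⟨ from-does (output (Mᵢ i) run ≟ₛ bin (2 ^ m)) (trans (sym claims≡) claimed) ⟩
      bin (2 ^ m)                  ∎)
    where
    open ≡-Reasoning
    census≡ : census B (suc m) ≡ val (replicate m true)
    census≡ = suc-injective (trans (+-comm 1 _) (trans (cong (census B (suc m) +_) (sym (cong length eq)))
                            (trans (census-B-stage i) (sym (suc-val-ones m)))))
  by-claim (inj₂ (unclaimed , eq)) = true≢false (trans (sym claims) unclaimed)
    where
    census≡ : census B (suc m) ≡ 2 ^ m
    census≡ = trans (sym (+-identityʳ _)) (trans (cong (census B (suc m) +_) (sym (cong length eq))) (census-B-stage i))
    claims : claims2^m ≡ true
    claims = trans claims≡ (dec-true (output (Mᵢ i) run ≟ₛ bin (2 ^ m)) (trans answers-census (cong bin census≡)))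
    true≢false : true ≢ false
    true≢false ()

census-not-FP : ¬ CensusInFP A B
census-not-FP (f , (M , k , M-computes) , f-census) with machineAt-complete M k
... | i , simulates = stage-defeats i (simulates M-computes) (f-census (suc (stageLength i)))

theorem5p3 : Σ Lang λ A → Σ Lang λ B → Scalable A B × ¬ CensusInFP A B
theorem5p3 = A , B , swapped-scalable D , census-not-FP
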